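{- Let $p$ be an odd prime and let $k$ be an integer with $1\leq k\leq p-1$. Then $$\sum_{i=1}^k\frac{1}{(k-i)!}\left(\sum_{m=1}^p\frac{(p-1)!}{(p-m)!\,(i+p)!}\left\{{i+p\atop m}\right\}_{\leq p-1}\right)-\frac{1}{(k-1)!}\equiv -\frac{1}{k!}H_k \pmod{p},$$ where $H_k=\sum_{j=1}^k\frac{1}{j}$ is the $k$-th harmonic number.
   Context: For integers $n\geq k\geq 0$ and $r\geq 1$, the $r$-restricted Stirling number of the second kind $\left\{{n\atop k}\right\}_{\leq r}$ is the number of partitions of an $n$-element set into $k$ nonempty blocks, each of size at most $r$; equivalently it is defined by the generating function $\frac{1}{k!}\left(\sum_{m=1}^r\frac{t^m}{m!}\right)^k=\sum_{n\geq k}\left\{{n\atop k}\right\}_{\leq r}\frac{t^n}{n!}$. The congruence is meant in the ring $\mathbb{Z}_{(p)}$ of rationals with denominator prime to $p$ (both sides lie in $\mathbb{Z}_{(p)}$), i.e. the difference of the two sides lies in $p\mathbb{Z}_{(p)}$. -}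

module Defs where

open import Data.Nat as ℕ using (ℕ; zero; suc; _∸_; _!; NonZero)
open import Data.Nat.Properties using (_!≢0)
open import Data.Nat.Combinatorics using (_C_)
open import Data.Integer as ℤ using (ℤ; +_)
open import Data.Integer.Divisibility using () renaming (_∣_ to _∣ℤ_)
open import Data.Rational as ℚ using (ℚ; _/_; _+_; _-_; _*_; 0ℚ)
open import Data.Product using (∃₂; _×_)
open import Relation.Binary.PropositionalEquality using (_≡_)
open import Relation.Nullary using (¬_)

sumFrom : ℕ → ℕ → (ℕ → ℚ) → ℚ
sumFrom a b f = go ((suc b) ∸ a) a
  where
  go : ℕ → ℕ → ℚ
  go zero    _ = 0ℚ
  go (suc c) i = f i + go c (suc i)

sumℕ : ℕ → (ℕ → ℕ) → ℕ
sumℕ zero    f = 0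
sumℕ (suc c) f = f c ℕ.+ sumℕ c f

-- r-restricted Stirling numbers of the second kind  {n k}_{≤ r}:
-- number of partitions of an n-set into k nonempty blocks, each of size ≤ r.
-- Defined by the standard combinatorial recursion obtained by removing the
-- block containing the last element: that block has size j+1 (0 ≤ j ≤ r-1),
-- its other j elements are chosen among the remaining n in (n C j) ways.
stirling≤ : ℕ → ℕ → ℕ → ℕ
stirling≤ r zero    zero    = 1
stirling≤ r zero    (suc k) = 0
stirling≤ r (suc n) zero    = 0
stirling≤ r (suc n) (suc k) = sumℕ r (λ j → (n C j) ℕ.* stirling≤ r (n ∸ j) k)

inv! : ℕ → ℚ
inv! n = (+ 1 / (n !)) {{n !≢0}}

ℕ→ℚ : ℕ → ℚ
ℕ→ℚ n = + n / 1

-- 1 / j for j ≥ 1 (the value at j = 0 is irrelevant, set to 0)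
recip : ℕ → ℚ
recip zero    = 0ℚ
recip (suc j) = + 1 / suc j

H : ℕ → ℚ
H k = sumFrom 1 k recip

-- x ≡ y (mod p) in Z_(p): x - y = p * z with z ∈ Z_(p), i.e.
-- (x - y) * b = p * a for some integers a, b with p ∤ b.
_≡_[modℚ_] : ℚ → ℚ → ℕ → Set
x ≡ y [modℚ p ] =
  ∃₂ λ (a b : ℤ) → (¬ (+ p ∣ℤ b)) × ((x - y) * (b / 1) ≡ (+ p / 1) * (a / 1))

-- Let ê = Σ_{j≤r} t^j/j! be the exponential series truncated at degree r = p - 1.
-- The column generating functions of the restricted Stirling numbers give
-- Σ_m (y)_m {n m}_{≤r} t^n/n! = ê^y, so p times the i-th inner sum s_i is the
-- coefficient of t^(i+p) in ê^p. As ê' = ê - t^r/r!, differentiating ê^p gives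
-- (i+p) s_i = [t^(i+p-1)] ê^p - [t^i] ê^(p-1) / r!. Modulo p, the first term is
-- p s_(i-1) ≡ 0 for i ≥ 2 and (p^r - 1)/r! ≡ 1 for i = 1, the low coefficients of
-- ê^(p-1) are (p-1)^i/i! ≡ (-1)^i/i!, and 1/r! ≡ -1 by Wilson's theorem. Hence
-- s_1 ≡ 0 and s_i ≡ (-1)^i/(i·i!) for i ≥ 2, and the sum in the theorem becomes
-- Σ_{i=1}^k (-1)^i/(i·i!·(k-i)!) = -H_k/k!. The identities between coefficients
-- are all proved by comparing formal derivatives.

module Submission where

open import Defs
open import Data.Empty using (⊥-elim)
open import Data.Integer as ℤ using (ℤ)
import Data.Integer.Properties as ℤ
import Data.Integer.Tactic.RingSolver as ℤ-Solver
open import Data.Nat as ℕ using (ℕ; zero; suc; _∸_; _!; NonZero; _≤_; _<_; z≤n; s≤s)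
import Data.Nat.Properties as ℕ
open import Data.Nat.Combinatorics using (_C_; nCk+nC[k+1]≡[n+1]C[k+1]; k![n∸k]!∣n!)
open import Data.Nat.Combinatorics.Specification using (nCk≡n!/k![n-k]!; k>n⇒nCk≡0)
open import Data.Nat.DivMod using (m/n*n≡m)
open import Data.Nat.Divisibility using (_∣_; divides; _∣0; ∣-refl; ∣m∣n⇒∣m+n; ∣m+n∣m⇒∣n; ∣1⇒≡1; ∣⇒≤)
open import Data.Nat.Primality using (Prime; euclidsLemma; ¬prime[0]; ¬prime[1]; prime⇒irreducible; prime⇒nonTrivial)
open import Data.Product using (_,_)
open import Data.Rational as ℚ using (ℚ; _/_; _+_; _-_; _*_; -_; 0ℚ; 1ℚ; toℚᵘ)
import Data.Rational.Properties as ℚ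
import Data.Rational.Unnormalised as ℚᵘ
import Data.Rational.Unnormalised.Properties as ℚᵘ
open import Data.Sum using (_⊎_; inj₁; inj₂; [_,_]′)
open import Algebra.Definitions.RawSemiring ℚ.+-*-rawSemiring using (_^_)
open import Function using (_∘_)
open import Level using (0ℓ)
open import Relation.Binary.Bundles using (Setoid)
open import Relation.Binary.PropositionalEquality
open import Relation.Nullary using (yes; no; ¬_)
open import Relation.Nullary.Decidable.Core using (dec⇒maybe)
import Tactic.RingSolver.Core.AlmostCommutativeRing as ACR
open import Tactic.RingSolver using (solve-∀)

open ≡-Reasoning

ℚ-ring : ACR.AlmostCommutativeRing 0ℓ 0ℓ
ℚ-ring = ACR.fromCommutativeRing ℚ.+-*-commutativeRing (λ x → dec⇒maybe (0ℚ ℚ.≟ x))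

ℤ→ℚ : ℤ → ℚ
ℤ→ℚ z = z / 1

toℚᵘ-ℤ→ℚ : ∀ z → toℚᵘ (ℤ→ℚ z) ℚᵘ.≃ ℚᵘ.mkℚᵘ z 0
toℚᵘ-ℤ→ℚ z = ℚ.toℚᵘ-fromℚᵘ (ℚᵘ.mkℚᵘ z 0)

ℤ→ℚ-+ : ∀ a b → ℤ→ℚ (a ℤ.+ b) ≡ ℤ→ℚ a + ℤ→ℚ b
ℤ→ℚ-+ a b = ℚ.toℚᵘ-injective (ℚᵘ.≃-trans (toℚᵘ-ℤ→ℚ (a ℤ.+ b)) (ℚᵘ.≃-sym
  (ℚᵘ.≃-trans (ℚ.toℚᵘ-homo-+ (ℤ→ℚ a) (ℤ→ℚ b))
  (ℚᵘ.≃-trans (ℚᵘ.+-cong (toℚᵘ-ℤ→ℚ a) (toℚᵘ-ℤ→ℚ b)) (ℚᵘ.*≡* (over-1 a b))))))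
  where
  over-1 : ∀ a b → (a ℤ.* ℤ.+ 1 ℤ.+ b ℤ.* ℤ.+ 1) ℤ.* ℤ.+ 1 ≡ (a ℤ.+ b) ℤ.* ℤ.+ 1
  over-1 = ℤ-Solver.solve-∀

ℤ→ℚ-* : ∀ a b → ℤ→ℚ (a ℤ.* b) ≡ ℤ→ℚ a * ℤ→ℚ b
ℤ→ℚ-* a b = ℚ.toℚᵘ-injective (ℚᵘ.≃-trans (toℚᵘ-ℤ→ℚ (a ℤ.* b)) (ℚᵘ.≃-sym
  (ℚᵘ.≃-trans (ℚ.toℚᵘ-homo-* (ℤ→ℚ a) (ℤ→ℚ b))
  (ℚᵘ.≃-trans (ℚᵘ.*-cong (toℚᵘ-ℤ→ℚ a) (toℚᵘ-ℤ→ℚ b)) (ℚᵘ.*≡* refl)))))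

ℤ→ℚ-neg : ∀ a → ℤ→ℚ (ℤ.- a) ≡ - ℤ→ℚ a
ℤ→ℚ-neg a = begin
  ℤ→ℚ (ℤ.- a)                      ≡⟨ add-and-subtract (ℤ→ℚ (ℤ.- a)) (ℤ→ℚ a) ⟩
  ℤ→ℚ (ℤ.- a) + ℤ→ℚ a + - ℤ→ℚ a   ≡⟨ cong (_+ - ℤ→ℚ a) (sym (ℤ→ℚ-+ (ℤ.- a) a)) ⟩
  ℤ→ℚ (ℤ.- a ℤ.+ a) + - ℤ→ℚ a     ≡⟨ cong (λ u → ℤ→ℚ u + - ℤ→ℚ a) (ℤ.+-inverseˡ a) ⟩
  0ℚ + - ℤ→ℚ a                      ≡⟨ ℚ.+-identityˡ _ ⟩
  - ℤ→ℚ a                            ∎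
  where
  add-and-subtract : ∀ u v → u ≡ u + v + - v
  add-and-subtract = solve-∀ ℚ-ring

ℕ→ℚ-+ : ∀ m n → ℕ→ℚ (m ℕ.+ n) ≡ ℕ→ℚ m + ℕ→ℚ n
ℕ→ℚ-+ m n = ℤ→ℚ-+ (ℤ.+ m) (ℤ.+ n)

ℕ→ℚ-* : ∀ m n → ℕ→ℚ (m ℕ.* n) ≡ ℕ→ℚ m * ℕ→ℚ n
ℕ→ℚ-* m n = trans (cong ℤ→ℚ (ℤ.pos-* m n)) (ℤ→ℚ-* (ℤ.+ m) (ℤ.+ n))

ℕ→ℚ-suc : ∀ n → ℕ→ℚ (suc n) ≡ 1ℚ + ℕ→ℚ n
ℕ→ℚ-suc = ℕ→ℚ-+ 1

1/n*n≡1 : ∀ n .{{_ : NonZero n}} → (ℤ.+ 1 / n) * ℕ→ℚ n ≡ 1ℚ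
1/n*n≡1 (suc n) = ℚ.toℚᵘ-injective (ℚᵘ.≃-trans (ℚ.toℚᵘ-homo-* (ℤ.+ 1 / suc n) (ℕ→ℚ (suc n)))
  (ℚᵘ.≃-trans (ℚᵘ.*-cong (ℚ.toℚᵘ-fromℚᵘ (ℚᵘ.mkℚᵘ (ℤ.+ 1) n)) (toℚᵘ-ℤ→ℚ (ℤ.+ suc n)))
  (ℚᵘ.*≡* (cross n))))
  where
  cross : ∀ n → (ℤ.+ 1 ℤ.* ℤ.+ suc n) ℤ.* ℤ.+ 1 ≡ ℤ.+ 1 ℤ.* ℤ.+ (suc n ℕ.* 1)
  cross n = trans (unit-factors (ℤ.+ suc n)) (cong (ℤ.+ 1 ℤ.*_) (sym (ℤ.pos-* (suc n) 1)))
    where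
    unit-factors : ∀ z → (ℤ.+ 1 ℤ.* z) ℤ.* ℤ.+ 1 ≡ ℤ.+ 1 ℤ.* (z ℤ.* ℤ.+ 1)
    unit-factors = ℤ-Solver.solve-∀

inv!*n!≡1 : ∀ n → inv! n * ℕ→ℚ (n !) ≡ 1ℚ
inv!*n!≡1 n = 1/n*n≡1 (n !) {{n ℕ.!≢0}}

ℕ→ℚ-cancelˡ : ∀ c .{{_ : NonZero c}} {x y} → ℕ→ℚ c * x ≡ ℕ→ℚ c * y → x ≡ y
ℕ→ℚ-cancelˡ c {x} {y} eq = begin
  x                            ≡⟨ sym (multiply-by-one x) ⟩
  (ℤ.+ 1 / c) * ℕ→ℚ c * x      ≡⟨ ℚ.*-assoc (ℤ.+ 1 / c) _ x ⟩
  (ℤ.+ 1 / c) * (ℕ→ℚ c * x)    ≡⟨ cong ((ℤ.+ 1 / c) *_) eq ⟩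
  (ℤ.+ 1 / c) * (ℕ→ℚ c * y)    ≡⟨ sym (ℚ.*-assoc (ℤ.+ 1 / c) _ y) ⟩
  (ℤ.+ 1 / c) * ℕ→ℚ c * y      ≡⟨ multiply-by-one y ⟩
  y                            ∎
  where
  multiply-by-one : ∀ z → (ℤ.+ 1 / c) * ℕ→ℚ c * z ≡ z
  multiply-by-one z = trans (cong (_* z) (1/n*n≡1 c)) (ℚ.*-identityˡ z)

[1+n]*inv![1+n]≡inv!n : ∀ n → ℕ→ℚ (suc n) * inv! (suc n) ≡ inv! n
[1+n]*inv![1+n]≡inv!n n = ℕ→ℚ-cancelˡ (n !) {{n ℕ.!≢0}} (begin
  ℕ→ℚ (n !) * (ℕ→ℚ (suc n) * inv! (suc n))  ≡⟨ regroup (ℕ→ℚ (n !)) (ℕ→ℚ (suc n)) (inv! (suc n)) ⟩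
  inv! (suc n) * (ℕ→ℚ (suc n) * ℕ→ℚ (n !))  ≡⟨ cong (inv! (suc n) *_) (sym (ℕ→ℚ-* (suc n) (n !))) ⟩
  inv! (suc n) * ℕ→ℚ (suc n !)               ≡⟨ inv!*n!≡1 (suc n) ⟩
  1ℚ                                          ≡⟨ sym (inv!*n!≡1 n) ⟩
  inv! n * ℕ→ℚ (n !)                         ≡⟨ ℚ.*-comm (inv! n) _ ⟩
  ℕ→ℚ (n !) * inv! n                         ∎)
  where
  regroup : ∀ a b c → a * (b * c) ≡ c * (b * a)
  regroup = solve-∀ ℚ-ring

nCk*k!*[n∸k]!≡n! : ∀ {n k} → k ≤ n → (n C k) ℕ.* (k ! ℕ.* (n ∸ k) !) ≡ n !
nCk*k!*[n∸k]!≡n! {n} {k} k≤n = trans (cong (ℕ._* (k ! ℕ.* (n ∸ k) !)) (nCk≡n!/k![n-k]! k≤n))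
  (m/n*n≡m {{ℕ._!*_!≢0 k (n ∸ k)}} (k![n∸k]!∣n! k≤n))

nCk*inv!n≡inv!k*inv![n∸k] : ∀ {n k} → k ≤ n → ℕ→ℚ (n C k) * inv! n ≡ inv! k * inv! (n ∸ k)
nCk*inv!n≡inv!k*inv![n∸k] {n} {k} k≤n = ℕ→ℚ-cancelˡ (n !) {{n ℕ.!≢0}} (begin
  ℕ→ℚ (n !) * (Ĉ * inv! n)                          ≡⟨ regroup (ℕ→ℚ (n !)) Ĉ (inv! n) ⟩
  Ĉ * (inv! n * ℕ→ℚ (n !))                          ≡⟨ cong (Ĉ *_) (trans (inv!*n!≡1 n) (sym inverses-cancel)) ⟩
  Ĉ * ((inv! k * ℕ→ℚ (k !)) * (inv! (n ∸ k) * ℕ→ℚ ((n ∸ k) !)))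
    ≡⟨ regroup₂ Ĉ (inv! k) (ℕ→ℚ (k !)) (inv! (n ∸ k)) (ℕ→ℚ ((n ∸ k) !)) ⟩
  (Ĉ * (ℕ→ℚ (k !) * ℕ→ℚ ((n ∸ k) !))) * (inv! k * inv! (n ∸ k))
    ≡⟨ cong (_* (inv! k * inv! (n ∸ k))) (sym (trans (ℕ→ℚ-* (n C k) _) (cong (Ĉ *_) (ℕ→ℚ-* (k !) _)))) ⟩
  ℕ→ℚ ((n C k) ℕ.* (k ! ℕ.* (n ∸ k) !)) * (inv! k * inv! (n ∸ k))
    ≡⟨ cong (λ m → ℕ→ℚ m * (inv! k * inv! (n ∸ k))) (nCk*k!*[n∸k]!≡n! k≤n) ⟩
  ℕ→ℚ (n !) * (inv! k * inv! (n ∸ k))               ∎)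
  where
  Ĉ = ℕ→ℚ (n C k)
  inverses-cancel : (inv! k * ℕ→ℚ (k !)) * (inv! (n ∸ k) * ℕ→ℚ ((n ∸ k) !)) ≡ 1ℚ
  inverses-cancel = trans (cong₂ _*_ (inv!*n!≡1 k) (inv!*n!≡1 (n ∸ k))) (ℚ.*-identityˡ 1ℚ)
  regroup : ∀ a b c → a * (b * c) ≡ b * (c * a)
  regroup = solve-∀ ℚ-ring
  regroup₂ : ∀ c i f j g → c * ((i * f) * (j * g)) ≡ (c * (f * g)) * (i * j)
  regroup₂ = solve-∀ ℚ-ring

-- Recursion on the first summand, so that shifting the summation index is definitional.
Σ< : ℕ → (ℕ → ℚ) → ℚ
Σ< zero    f = 0ℚ
Σ< (suc n) f = f 0 + Σ< n (f ∘ suc)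

infix 6.5 Σ<
syntax Σ< n (λ j → e) = Σ[ j < n ] e

Σ-cong : ∀ n {f g} → (∀ j → j < n → f j ≡ g j) → Σ< n f ≡ Σ< n g
Σ-cong zero    eq = refl
Σ-cong (suc n) eq = cong₂ _+_ (eq 0 (s≤s z≤n)) (Σ-cong n (λ j j<n → eq (suc j) (s≤s j<n)))

Σ-zero : ∀ n {f} → (∀ j → j < n → f j ≡ 0ℚ) → Σ< n f ≡ 0ℚ
Σ-zero zero    eq = refl
Σ-zero (suc n) eq = trans (cong₂ _+_ (eq 0 (s≤s z≤n)) (Σ-zero n (λ j j<n → eq (suc j) (s≤s j<n)))) (ℚ.+-identityˡ 0ℚ)

Σ-+ : ∀ n f g → Σ[ j < n ] (f j + g j) ≡ Σ< n f + Σ< n g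
Σ-+ zero    f g = refl
Σ-+ (suc n) f g = trans (cong ((f 0 + g 0) +_) (Σ-+ n (f ∘ suc) (g ∘ suc))) (interchange (f 0) (g 0) _ _)
  where
  interchange : ∀ a b x y → a + b + (x + y) ≡ a + x + (b + y)
  interchange = solve-∀ ℚ-ring

Σ-*ˡ : ∀ n a f → Σ[ j < n ] (a * f j) ≡ a * Σ< n f
Σ-*ˡ zero    a f = sym (ℚ.*-zeroʳ a)
Σ-*ˡ (suc n) a f = trans (cong (a * f 0 +_) (Σ-*ˡ n a (f ∘ suc))) (sym (ℚ.*-distribˡ-+ a (f 0) _))

Σ-*ʳ : ∀ n a f → Σ[ j < n ] (f j * a) ≡ Σ< n f * a
Σ-*ʳ n a f = trans (Σ-cong n (λ j _ → ℚ.*-comm (f j) a)) (trans (Σ-*ˡ n a f) (ℚ.*-comm a (Σ< n f)))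

Σ-neg : ∀ n f → Σ[ j < n ] (- f j) ≡ - Σ< n f
Σ-neg zero    f = refl
Σ-neg (suc n) f = trans (cong (- f 0 +_) (Σ-neg n (f ∘ suc))) (sym (ℚ.neg-distrib-+ (f 0) _))

Σ-suc : ∀ n f → Σ< (suc n) f ≡ Σ< n f + f n
Σ-suc zero    f = trans (ℚ.+-identityʳ (f 0)) (sym (ℚ.+-identityˡ (f 0)))
Σ-suc (suc n) f = trans (cong (f 0 +_) (Σ-suc n (f ∘ suc))) (sym (ℚ.+-assoc (f 0) _ _))

Σ-split : ∀ m n f → Σ< (m ℕ.+ n) f ≡ Σ< m f + Σ[ j < n ] f (m ℕ.+ j)
Σ-split zero    n f = sym (ℚ.+-identityˡ _)
Σ-split (suc m) n f = trans (cong (f 0 +_) (Σ-split m n (f ∘ suc))) (sym (ℚ.+-assoc (f 0) _ _))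

Σ-support : ∀ m n f → (∀ j → m ≤ j → f j ≡ 0ℚ) → (∀ j → n ≤ j → f j ≡ 0ℚ) → Σ< m f ≡ Σ< n f
Σ-support m n f vanishes-from-m vanishes-from-n = begin
  Σ< m f            ≡⟨ sym (drop-tail m n vanishes-from-m) ⟩
  Σ< (m ℕ.+ n) f    ≡⟨ cong (λ k → Σ< k f) (ℕ.+-comm m n) ⟩
  Σ< (n ℕ.+ m) f    ≡⟨ drop-tail n m vanishes-from-n ⟩
  Σ< n f            ∎
  where
  drop-tail : ∀ a b → (∀ j → a ≤ j → f j ≡ 0ℚ) → Σ< (a ℕ.+ b) f ≡ Σ< a f
  drop-tail a b vanishes = begin
    Σ< (a ℕ.+ b) f                   ≡⟨ Σ-split a b f ⟩
    Σ< a f + Σ[ j < b ] f (a ℕ.+ j)  ≡⟨ cong (Σ< a f +_) (Σ-zero b (λ j _ → vanishes (a ℕ.+ j) (ℕ.m≤m+n a j))) ⟩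
    Σ< a f + 0ℚ                      ≡⟨ ℚ.+-identityʳ _ ⟩
    Σ< a f                           ∎

Σ-comm : ∀ m n (f : ℕ → ℕ → ℚ) → Σ[ i < m ] Σ[ j < n ] f i j ≡ Σ[ j < n ] Σ[ i < m ] f i j
Σ-comm zero    n f = sym (Σ-zero n (λ _ _ → refl))
Σ-comm (suc m) n f = trans (cong (Σ< n (f 0) +_) (Σ-comm m n (f ∘ suc)))
  (sym (Σ-+ n (f 0) (λ j → Σ[ i < m ] f (suc i) j)))

Σ-single : ∀ n k f → k < n → (∀ j → j < n → j ≢ k → f j ≡ 0ℚ) → Σ< n f ≡ f k
Σ-single (suc n) zero    f _ others≡0 =
  trans (cong (f 0 +_) (Σ-zero n (λ j j<n → others≡0 (suc j) (s≤s j<n) λ ()))) (ℚ.+-identityʳ (f 0))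
Σ-single (suc n) (suc k) f (s≤s k<n) others≡0 =
  trans (cong₂ _+_ (others≡0 0 (s≤s z≤n) λ ())
                   (Σ-single n k (f ∘ suc) k<n (λ j j<n j≢k → others≡0 (suc j) (s≤s j<n) (j≢k ∘ ℕ.suc-injective))))
    (ℚ.+-identityˡ _)

sumℕ-Σ : ∀ n f → ℕ→ℚ (sumℕ n f) ≡ Σ[ j < n ] ℕ→ℚ (f j)
sumℕ-Σ zero    f = refl
sumℕ-Σ (suc n) f = begin
  ℕ→ℚ (f n ℕ.+ sumℕ n f)                ≡⟨ ℕ→ℚ-+ (f n) (sumℕ n f) ⟩
  ℕ→ℚ (f n) + ℕ→ℚ (sumℕ n f)            ≡⟨ cong (ℕ→ℚ (f n) +_) (sumℕ-Σ n f) ⟩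
  ℕ→ℚ (f n) + Σ[ j < n ] ℕ→ℚ (f j)       ≡⟨ ℚ.+-comm (ℕ→ℚ (f n)) _ ⟩
  Σ[ j < n ] ℕ→ℚ (f j) + ℕ→ℚ (f n)       ≡⟨ sym (Σ-suc n (ℕ→ℚ ∘ f)) ⟩
  Σ[ j < suc n ] ℕ→ℚ (f j)               ∎

sumFrom-Σ : ∀ n i b f → suc b ∸ i ≡ n → sumFrom i b f ≡ Σ[ j < n ] f (i ℕ.+ j)
sumFrom-Σ zero    i b f empty rewrite empty = refl
sumFrom-Σ (suc n) i b f nonempty with i ℕ.≤? b
... | no i≰b = ⊥-elim (ℕ.0≢1+n (trans (sym (ℕ.m≤n⇒m∸n≡0 (ℕ.≰⇒> i≰b))) nonempty))
... | yes i≤b = begin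
  sumFrom i b f                            ≡⟨ first-term ⟩
  f i + sumFrom (suc i) b f                ≡⟨ cong (f i +_) (sumFrom-Σ n (suc i) b f (ℕ.suc-injective (trans (sym (ℕ.+-∸-assoc 1 i≤b)) nonempty))) ⟩
  f i + Σ[ j < n ] f (suc i ℕ.+ j)         ≡⟨ cong₂ _+_ (cong f (sym (ℕ.+-identityʳ i))) (Σ-cong n (λ j _ → cong f (sym (ℕ.+-suc i j)))) ⟩
  f (i ℕ.+ 0) + Σ[ j < n ] f (i ℕ.+ suc j) ∎
  where
  first-term : sumFrom i b f ≡ f i + sumFrom (suc i) b f
  first-term rewrite ℕ.+-∸-assoc 1 i≤b = refl

sumFrom-1 : ∀ n f → sumFrom 1 n f ≡ Σ[ j < n ] f (suc j)
sumFrom-1 n f = sumFrom-Σ n 1 n f refl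

Series : Set
Series = ℕ → ℚ

infixl 7 _⋆_

_⋆_ : Series → Series → Series
(f ⋆ g) n = Σ[ j < suc n ] f j * g (n ∸ j)

∂ : Series → Series
∂ f n = ℕ→ℚ (suc n) * f (suc n)

δ : Series
δ zero    = 1ℚ
δ (suc n) = 0ℚ

⋆-cong : ∀ n {f f′ g g′} → (∀ j → j ≤ n → f j ≡ f′ j) → (∀ j → j ≤ n → g j ≡ g′ j) →
         (f ⋆ g) n ≡ (f′ ⋆ g′) n
⋆-cong n f≡f′ g≡g′ = Σ-cong (suc n) λ j j<1+n →
  cong₂ _*_ (f≡f′ j (ℕ.≤-pred j<1+n)) (g≡g′ (n ∸ j) (ℕ.m∸n≤m n j))

⋆-congˡ : ∀ n {f f′} g → (∀ j → j ≤ n → f j ≡ f′ j) → (f ⋆ g) n ≡ (f′ ⋆ g) n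
⋆-congˡ n {f} {f′} g f≡f′ = ⋆-cong n {f} {f′} {g} {g} f≡f′ (λ _ _ → refl)

⋆-congʳ : ∀ n f {g g′} → (∀ j → j ≤ n → g j ≡ g′ j) → (f ⋆ g) n ≡ (f ⋆ g′) n
⋆-congʳ n f {g} {g′} g≡g′ = ⋆-cong n {f} {f} {g} {g′} (λ _ _ → refl) g≡g′

⋆-distribʳ-+ : ∀ n f f′ g → ((λ j → f j + f′ j) ⋆ g) n ≡ (f ⋆ g) n + (f′ ⋆ g) n
⋆-distribʳ-+ n f f′ g = trans (Σ-cong (suc n) λ j _ → ℚ.*-distribʳ-+ (g (n ∸ j)) (f j) (f′ j))
  (Σ-+ (suc n) (λ j → f j * g (n ∸ j)) (λ j → f′ j * g (n ∸ j)))

⋆-distribˡ-+ : ∀ n f g g′ → (f ⋆ (λ j → g j + g′ j)) n ≡ (f ⋆ g) n + (f ⋆ g′) n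
⋆-distribˡ-+ n f g g′ = trans (Σ-cong (suc n) λ j _ → ℚ.*-distribˡ-+ (f j) (g (n ∸ j)) (g′ (n ∸ j)))
  (Σ-+ (suc n) (λ j → f j * g (n ∸ j)) (λ j → f j * g′ (n ∸ j)))

⋆-scaleˡ : ∀ n a f g → ((λ j → a * f j) ⋆ g) n ≡ a * (f ⋆ g) n
⋆-scaleˡ n a f g = trans (Σ-cong (suc n) λ j _ → ℚ.*-assoc a (f j) (g (n ∸ j)))
  (Σ-*ˡ (suc n) a (λ j → f j * g (n ∸ j)))

⋆-scaleʳ : ∀ n a f g → (f ⋆ (λ j → a * g j)) n ≡ a * (f ⋆ g) n
⋆-scaleʳ n a f g = trans (Σ-cong (suc n) λ j _ → left-comm (f j) a (g (n ∸ j)))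
  (Σ-*ˡ (suc n) a (λ j → f j * g (n ∸ j)))
  where
  left-comm : ∀ x a y → x * (a * y) ≡ a * (x * y)
  left-comm = solve-∀ ℚ-ring

⋆-negˡ : ∀ n f g → ((λ j → - f j) ⋆ g) n ≡ - (f ⋆ g) n
⋆-negˡ n f g = trans (Σ-cong (suc n) λ j _ → sym (ℚ.neg-distribˡ-* (f j) (g (n ∸ j))))
  (Σ-neg (suc n) (λ j → f j * g (n ∸ j)))

⋆-Σʳ : ∀ n m f (g : ℕ → Series) → (f ⋆ (λ k → Σ[ i < m ] g i k)) n ≡ Σ[ i < m ] (f ⋆ g i) n
⋆-Σʳ n m f g = trans (Σ-cong (suc n) λ j _ → sym (Σ-*ˡ m (f j) (λ i → g i (n ∸ j))))
  (Σ-comm (suc n) m (λ j i → f j * g i (n ∸ j)))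

⋆-identityˡ : ∀ n g → (δ ⋆ g) n ≡ g n
⋆-identityˡ n g = trans (Σ-single (suc n) 0 (λ j → δ j * g (n ∸ j)) (s≤s z≤n) off-diagonal) (ℚ.*-identityˡ (g n))
  where
  off-diagonal : ∀ j → j < suc n → j ≢ 0 → δ j * g (n ∸ j) ≡ 0ℚ
  off-diagonal zero    _ j≢0 = ⊥-elim (j≢0 refl)
  off-diagonal (suc j) _ _   = ℚ.*-zeroˡ (g (n ∸ suc j))

-- The Leibniz rule comes from splitting the weight n of (f ⋆ g) n as j + (n - j).
⋆-weighted : ∀ n f g → ((λ j → ℕ→ℚ j * f j) ⋆ g) n + (f ⋆ (λ j → ℕ→ℚ j * g j)) n ≡ ℕ→ℚ n * (f ⋆ g) n
⋆-weighted n f g = begin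
  Σ[ j < suc n ] (ℕ→ℚ j * f j * g (n ∸ j)) + Σ[ j < suc n ] (f j * (ℕ→ℚ (n ∸ j) * g (n ∸ j)))
    ≡⟨ sym (Σ-+ (suc n) (λ j → ℕ→ℚ j * f j * g (n ∸ j)) (λ j → f j * (ℕ→ℚ (n ∸ j) * g (n ∸ j)))) ⟩
  Σ[ j < suc n ] (ℕ→ℚ j * f j * g (n ∸ j) + f j * (ℕ→ℚ (n ∸ j) * g (n ∸ j)))
    ≡⟨ Σ-cong (suc n) (λ j j<1+n → weights-add-up j (ℕ.≤-pred j<1+n)) ⟩
  Σ[ j < suc n ] (ℕ→ℚ n * (f j * g (n ∸ j)))
    ≡⟨ Σ-*ˡ (suc n) (ℕ→ℚ n) (λ j → f j * g (n ∸ j)) ⟩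
  ℕ→ℚ n * (f ⋆ g) n ∎
  where
  collect : ∀ a b x y → a * x * y + x * (b * y) ≡ (a + b) * (x * y)
  collect = solve-∀ ℚ-ring
  weights-add-up : ∀ j → j ≤ n → ℕ→ℚ j * f j * g (n ∸ j) + f j * (ℕ→ℚ (n ∸ j) * g (n ∸ j)) ≡ ℕ→ℚ n * (f j * g (n ∸ j))
  weights-add-up j j≤n = trans (collect (ℕ→ℚ j) (ℕ→ℚ (n ∸ j)) (f j) (g (n ∸ j)))
    (cong (_* (f j * g (n ∸ j))) (trans (sym (ℕ→ℚ-+ j (n ∸ j))) (cong ℕ→ℚ (ℕ.m+[n∸m]≡n j≤n))))

⋆-weightedˡ : ∀ n f g → ((λ j → ℕ→ℚ j * f j) ⋆ g) (suc n) ≡ (∂ f ⋆ g) n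
⋆-weightedˡ n f g = trans (cong (_+ (∂ f ⋆ g) n) (trans (cong (_* g (suc n)) (ℚ.*-zeroˡ (f 0))) (ℚ.*-zeroˡ (g (suc n)))))
  (ℚ.+-identityˡ _)

⋆-weightedʳ : ∀ n f g → (f ⋆ (λ j → ℕ→ℚ j * g j)) (suc n) ≡ (f ⋆ ∂ g) n
⋆-weightedʳ zero    f g = cong (f 0 * (ℕ→ℚ 1 * g 1) +_)
  (trans (ℚ.+-identityʳ _) (trans (cong (f 1 *_) (ℚ.*-zeroˡ (g 0))) (ℚ.*-zeroʳ (f 1))))
⋆-weightedʳ (suc n) f g = cong (f 0 * (ℕ→ℚ (suc (suc n)) * g (suc (suc n))) +_) (⋆-weightedʳ n (f ∘ suc) g)

∂-⋆ : ∀ n f g → ∂ (f ⋆ g) n ≡ (∂ f ⋆ g) n + (f ⋆ ∂ g) n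
∂-⋆ n f g = trans (sym (⋆-weighted (suc n) f g)) (cong₂ _+_ (⋆-weightedˡ n f g) (⋆-weightedʳ n f g))

∂-cancel : ∀ n f g → ∂ f n ≡ ∂ g n → f (suc n) ≡ g (suc n)
∂-cancel n f g = ℕ→ℚ-cancelˡ (suc n)

∂-unique : ∀ {f g} → f 0 ≡ g 0 → (∀ n → f n ≡ g n → ∂ f n ≡ ∂ g n) → ∀ n → f n ≡ g n
∂-unique f₀≡g₀ ∂f≡∂g zero    = f₀≡g₀
∂-unique {f} {g} f₀≡g₀ ∂f≡∂g (suc n) = ∂-cancel n f g (∂f≡∂g n (∂-unique f₀≡g₀ ∂f≡∂g n))

-- Commutativity and associativity follow from the Leibniz rule and ∂-unique, without reindexing sums.
⋆-comm : ∀ n f g → (f ⋆ g) n ≡ (g ⋆ f) n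
⋆-comm zero    f g = cong (_+ 0ℚ) (ℚ.*-comm (f 0) (g 0))
⋆-comm (suc n) f g = ∂-cancel n (f ⋆ g) (g ⋆ f) (begin
  ∂ (f ⋆ g) n                     ≡⟨ ∂-⋆ n f g ⟩
  (∂ f ⋆ g) n + (f ⋆ ∂ g) n       ≡⟨ cong₂ _+_ (⋆-comm n (∂ f) g) (⋆-comm n f (∂ g)) ⟩
  (g ⋆ ∂ f) n + (∂ g ⋆ f) n       ≡⟨ ℚ.+-comm ((g ⋆ ∂ f) n) ((∂ g ⋆ f) n) ⟩
  (∂ g ⋆ f) n + (g ⋆ ∂ f) n       ≡⟨ sym (∂-⋆ n g f) ⟩
  ∂ (g ⋆ f) n                     ∎)

⋆-assoc : ∀ n f g h → (f ⋆ g ⋆ h) n ≡ (f ⋆ (g ⋆ h)) n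
⋆-assoc zero    f g h = regroup (f 0) (g 0) (h 0)
  where
  regroup : ∀ x y z → (x * y + 0ℚ) * z + 0ℚ ≡ x * (y * z + 0ℚ) + 0ℚ
  regroup = solve-∀ ℚ-ring
⋆-assoc (suc n) f g h = ∂-cancel n (f ⋆ g ⋆ h) (f ⋆ (g ⋆ h)) (begin
  ∂ (f ⋆ g ⋆ h) n
    ≡⟨ ∂-⋆ n (f ⋆ g) h ⟩
  (∂ (f ⋆ g) ⋆ h) n + (f ⋆ g ⋆ ∂ h) n
    ≡⟨ cong (_+ (f ⋆ g ⋆ ∂ h) n) (⋆-congˡ n h (λ j _ → ∂-⋆ j f g)) ⟩
  ((λ j → (∂ f ⋆ g) j + (f ⋆ ∂ g) j) ⋆ h) n + (f ⋆ g ⋆ ∂ h) n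
    ≡⟨ cong (_+ (f ⋆ g ⋆ ∂ h) n) (⋆-distribʳ-+ n (∂ f ⋆ g) (f ⋆ ∂ g) h) ⟩
  (∂ f ⋆ g ⋆ h) n + (f ⋆ ∂ g ⋆ h) n + (f ⋆ g ⋆ ∂ h) n
    ≡⟨ cong₂ _+_ (cong₂ _+_ (⋆-assoc n (∂ f) g h) (⋆-assoc n f (∂ g) h)) (⋆-assoc n f g (∂ h)) ⟩
  (∂ f ⋆ (g ⋆ h)) n + (f ⋆ (∂ g ⋆ h)) n + (f ⋆ (g ⋆ ∂ h)) n
    ≡⟨ ℚ.+-assoc ((∂ f ⋆ (g ⋆ h)) n) ((f ⋆ (∂ g ⋆ h)) n) ((f ⋆ (g ⋆ ∂ h)) n) ⟩
  (∂ f ⋆ (g ⋆ h)) n + ((f ⋆ (∂ g ⋆ h)) n + (f ⋆ (g ⋆ ∂ h)) n)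
    ≡⟨ cong ((∂ f ⋆ (g ⋆ h)) n +_) (sym (⋆-distribˡ-+ n f (∂ g ⋆ h) (g ⋆ ∂ h))) ⟩
  (∂ f ⋆ (g ⋆ h)) n + (f ⋆ (λ j → (∂ g ⋆ h) j + (g ⋆ ∂ h) j)) n
    ≡⟨ cong ((∂ f ⋆ (g ⋆ h)) n +_) (⋆-congʳ n f (λ j _ → sym (∂-⋆ j g h))) ⟩
  (∂ f ⋆ (g ⋆ h)) n + (f ⋆ ∂ (g ⋆ h)) n
    ≡⟨ sym (∂-⋆ n f (g ⋆ h)) ⟩
  ∂ (f ⋆ (g ⋆ h)) n ∎)

⋆-left-comm : ∀ n f g h → (f ⋆ (g ⋆ h)) n ≡ (g ⋆ (f ⋆ h)) n
⋆-left-comm n f g h = begin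
  (f ⋆ (g ⋆ h)) n   ≡⟨ sym (⋆-assoc n f g h) ⟩
  (f ⋆ g ⋆ h) n     ≡⟨ ⋆-congˡ n h (λ j _ → ⋆-comm j f g) ⟩
  (g ⋆ f ⋆ h) n     ≡⟨ ⋆-assoc n g f h ⟩
  (g ⋆ (f ⋆ h)) n   ∎

infixr 8 _^⋆_

_^⋆_ : Series → ℕ → Series
f ^⋆ zero  = δ
f ^⋆ suc y = f ⋆ f ^⋆ y

∂-^⋆ : ∀ y n f → ∂ (f ^⋆ suc y) n ≡ ℕ→ℚ (suc y) * (∂ f ⋆ f ^⋆ y) n
∂-^⋆ zero n f = begin
  ∂ (f ⋆ δ) n                    ≡⟨ ∂-⋆ n f δ ⟩
  (∂ f ⋆ δ) n + (f ⋆ ∂ δ) n      ≡⟨ cong ((∂ f ⋆ δ) n +_) (Σ-zero (suc n) λ j _ → ∂δ≡0 (f j) (n ∸ j)) ⟩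
  (∂ f ⋆ δ) n + 0ℚ               ≡⟨ ℚ.+-identityʳ _ ⟩
  (∂ f ⋆ δ) n                    ≡⟨ sym (ℚ.*-identityˡ _) ⟩
  ℕ→ℚ 1 * (∂ f ⋆ δ) n            ∎
  where
  ∂δ≡0 : ∀ a m → a * ∂ δ m ≡ 0ℚ
  ∂δ≡0 a m = trans (cong (a *_) (ℚ.*-zeroʳ (ℕ→ℚ (suc m)))) (ℚ.*-zeroʳ a)
∂-^⋆ (suc y) n f = begin
  ∂ (f ⋆ f ^⋆ suc y) n
    ≡⟨ ∂-⋆ n f (f ^⋆ suc y) ⟩
  (∂ f ⋆ f ^⋆ suc y) n + (f ⋆ ∂ (f ^⋆ suc y)) n
    ≡⟨ cong (X +_) (⋆-congʳ n f (λ j _ → ∂-^⋆ y j f)) ⟩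
  X + (f ⋆ (λ j → ℕ→ℚ (suc y) * (∂ f ⋆ f ^⋆ y) j)) n
    ≡⟨ cong (X +_) (⋆-scaleʳ n (ℕ→ℚ (suc y)) f (∂ f ⋆ f ^⋆ y)) ⟩
  X + ℕ→ℚ (suc y) * (f ⋆ (∂ f ⋆ f ^⋆ y)) n
    ≡⟨ cong (λ u → X + ℕ→ℚ (suc y) * u) (⋆-left-comm n f (∂ f) (f ^⋆ y)) ⟩
  X + ℕ→ℚ (suc y) * X
    ≡⟨ factor X (ℕ→ℚ (suc y)) ⟩
  (1ℚ + ℕ→ℚ (suc y)) * X
    ≡⟨ cong (_* X) (sym (ℕ→ℚ-suc (suc y))) ⟩
  ℕ→ℚ (suc (suc y)) * X ∎
  where
  X = (∂ f ⋆ f ^⋆ suc y) n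
  factor : ∀ a b → a + b * a ≡ (1ℚ + b) * a
  factor = solve-∀ ℚ-ring

^⋆-cong : ∀ n {f g} → (∀ j → j ≤ n → f j ≡ g j) → ∀ y → (f ^⋆ y) n ≡ (g ^⋆ y) n
^⋆-cong n {f} {g} f≡g y = below y n ℕ.≤-refl
  where
  below : ∀ y m → m ≤ n → (f ^⋆ y) m ≡ (g ^⋆ y) m
  below zero    m _   = refl
  below (suc y) m m≤n = ⋆-cong m (λ j j≤m → f≡g j (ℕ.≤-trans j≤m m≤n))
                                 (λ j j≤m → below y j (ℕ.≤-trans j≤m m≤n))

^⋆-at-0 : ∀ {f} → f 0 ≡ 1ℚ → ∀ y → (f ^⋆ y) 0 ≡ 1ℚ
^⋆-at-0 f₀≡1 zero    = refl
^⋆-at-0 f₀≡1 (suc y) = cong₂ (λ a b → a * b + 0ℚ) f₀≡1 (^⋆-at-0 f₀≡1 y)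

^⋆-below : ∀ {f} → f 0 ≡ 0ℚ → ∀ y m → m < y → (f ^⋆ y) m ≡ 0ℚ
^⋆-below {f} f₀≡0 (suc y) m (s≤s m≤y) = Σ-zero (suc m) term≡0
  where
  term≡0 : ∀ j → j < suc m → f j * (f ^⋆ y) (m ∸ j) ≡ 0ℚ
  term≡0 zero    _         = trans (cong (_* (f ^⋆ y) m) f₀≡0) (ℚ.*-zeroˡ ((f ^⋆ y) m))
  term≡0 (suc j) (s≤s j<m) = trans (cong (f (suc j) *_) (^⋆-below f₀≡0 y (m ∸ suc j)
    (ℕ.<-≤-trans (ℕ.∸-monoʳ-< (s≤s z≤n) j<m) m≤y))) (ℚ.*-zeroʳ (f (suc j)))

^⋆-diagonal : ∀ {f} → f 0 ≡ 0ℚ → f 1 ≡ 1ℚ → ∀ n → (f ^⋆ n) n ≡ 1ℚ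
^⋆-diagonal f₀≡0 f₁≡1 zero = refl
^⋆-diagonal {f} f₀≡0 f₁≡1 (suc n) = begin
  (f ^⋆ suc n) (suc n)  ≡⟨ Σ-single (suc (suc n)) 1 _ (s≤s (s≤s z≤n)) off-diagonal ⟩
  f 1 * (f ^⋆ n) n      ≡⟨ cong₂ _*_ f₁≡1 (^⋆-diagonal f₀≡0 f₁≡1 n) ⟩
  1ℚ * 1ℚ               ≡⟨ ℚ.*-identityˡ 1ℚ ⟩
  1ℚ                    ∎
  where
  off-diagonal : ∀ j → j < suc (suc n) → j ≢ 1 → f j * (f ^⋆ n) (suc n ∸ j) ≡ 0ℚ
  off-diagonal zero          _               _   = trans (cong (_* (f ^⋆ n) (suc n)) f₀≡0) (ℚ.*-zeroˡ ((f ^⋆ n) (suc n)))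
  off-diagonal (suc zero)    _               j≢1 = ⊥-elim (j≢1 refl)
  off-diagonal (suc (suc j)) (s≤s (s≤s j<n)) _   = trans (cong (f (suc (suc j)) *_)
    (^⋆-below f₀≡0 n (n ∸ suc j) (ℕ.∸-monoʳ-< (s≤s z≤n) j<n))) (ℚ.*-zeroʳ (f (suc (suc j))))

1^n≡1 : ∀ n → 1ℚ ^ n ≡ 1ℚ
1^n≡1 zero    = refl
1^n≡1 (suc n) = trans (ℚ.*-identityˡ _) (1^n≡1 n)

0^n≡0 : ∀ {n} → 0 < n → 0ℚ ^ n ≡ 0ℚ
0^n≡0 {suc n} _ = ℚ.*-zeroˡ (0ℚ ^ n)

exp : ℚ → Series
exp a n = a ^ n * inv! n

exp-0 : ∀ n → exp 0ℚ n ≡ δ n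
exp-0 zero    = refl
exp-0 (suc n) = trans (cong (_* inv! (suc n)) (ℚ.*-zeroˡ (0ℚ ^ n))) (ℚ.*-zeroˡ (inv! (suc n)))

exp-1 : ∀ n → exp 1ℚ n ≡ inv! n
exp-1 n = trans (cong (_* inv! n) (1^n≡1 n)) (ℚ.*-identityˡ _)

∂-exp : ∀ a n → ∂ (exp a) n ≡ a * exp a n
∂-exp a n = begin
  ℕ→ℚ (suc n) * (a * a ^ n * inv! (suc n))    ≡⟨ regroup (ℕ→ℚ (suc n)) a (a ^ n) (inv! (suc n)) ⟩
  a * a ^ n * (ℕ→ℚ (suc n) * inv! (suc n))    ≡⟨ cong (a * a ^ n *_) ([1+n]*inv![1+n]≡inv!n n) ⟩
  a * a ^ n * inv! n                           ≡⟨ ℚ.*-assoc a _ _ ⟩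
  a * exp a n                                  ∎
  where
  regroup : ∀ s a b c → s * (a * b * c) ≡ a * b * (s * c)
  regroup = solve-∀ ℚ-ring

exp-⋆ : ∀ a b n → (exp a ⋆ exp b) n ≡ exp (a + b) n
exp-⋆ a b = ∂-unique refl step
  where
  step : ∀ n → (exp a ⋆ exp b) n ≡ exp (a + b) n → ∂ (exp a ⋆ exp b) n ≡ ∂ (exp (a + b)) n
  step n eq = begin
    ∂ (exp a ⋆ exp b) n
      ≡⟨ ∂-⋆ n (exp a) (exp b) ⟩
    (∂ (exp a) ⋆ exp b) n + (exp a ⋆ ∂ (exp b)) n
      ≡⟨ cong₂ _+_ (⋆-congˡ n (exp b) (λ j _ → ∂-exp a j)) (⋆-congʳ n (exp a) (λ j _ → ∂-exp b j)) ⟩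
    ((λ j → a * exp a j) ⋆ exp b) n + (exp a ⋆ (λ j → b * exp b j)) n
      ≡⟨ cong₂ _+_ (⋆-scaleˡ n a (exp a) (exp b)) (⋆-scaleʳ n b (exp a) (exp b)) ⟩
    a * (exp a ⋆ exp b) n + b * (exp a ⋆ exp b) n
      ≡⟨ sym (ℚ.*-distribʳ-+ _ a b) ⟩
    (a + b) * (exp a ⋆ exp b) n
      ≡⟨ cong ((a + b) *_) eq ⟩
    (a + b) * exp (a + b) n
      ≡⟨ sym (∂-exp (a + b) n) ⟩
    ∂ (exp (a + b)) n ∎

exp-1-^⋆ : ∀ y n → (exp 1ℚ ^⋆ y) n ≡ exp (ℕ→ℚ y) n
exp-1-^⋆ zero    n = sym (exp-0 n)
exp-1-^⋆ (suc y) n = begin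
  (exp 1ℚ ⋆ exp 1ℚ ^⋆ y) n       ≡⟨ ⋆-congʳ n (exp 1ℚ) (λ j _ → exp-1-^⋆ y j) ⟩
  (exp 1ℚ ⋆ exp (ℕ→ℚ y)) n       ≡⟨ exp-⋆ 1ℚ (ℕ→ℚ y) n ⟩
  exp (1ℚ + ℕ→ℚ y) n             ≡⟨ cong (λ a → exp a n) (sym (ℕ→ℚ-suc y)) ⟩
  exp (ℕ→ℚ (suc y)) n            ∎

indicator≤ : ℕ → ℕ → ℚ
indicator≤ r       zero    = 1ℚ
indicator≤ zero    (suc j) = 0ℚ
indicator≤ (suc r) (suc j) = indicator≤ r j

indicator≤-≤ : ∀ {r j} → j ≤ r → indicator≤ r j ≡ 1ℚ
indicator≤-≤ {j = zero}  _         = refl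
indicator≤-≤ {j = suc j} (s≤s j≤r) = indicator≤-≤ j≤r

indicator≤-> : ∀ {r j} → r < j → indicator≤ r j ≡ 0ℚ
indicator≤-> {zero}  {suc j} _         = refl
indicator≤-> {suc r} {suc j} (s≤s r<j) = indicator≤-> r<j

indicator≤-suc : ∀ {r j} → j ≢ r → indicator≤ r (suc j) ≡ indicator≤ r j
indicator≤-suc {zero}  {zero}  j≢r = ⊥-elim (j≢r refl)
indicator≤-suc {zero}  {suc j} _   = refl
indicator≤-suc {suc r} {zero}  _   = refl
indicator≤-suc {suc r} {suc j} j≢r = indicator≤-suc (j≢r ∘ cong suc)

expTrunc : ℕ → Series
expTrunc r j = indicator≤ r j * inv! j

expTrunc-≤ : ∀ {r j} → j ≤ r → expTrunc r j ≡ exp 1ℚ j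
expTrunc-≤ {r} {j} j≤r = begin
  indicator≤ r j * inv! j   ≡⟨ cong (_* inv! j) (indicator≤-≤ j≤r) ⟩
  1ℚ * inv! j               ≡⟨ ℚ.*-identityˡ _ ⟩
  inv! j                    ≡⟨ sym (exp-1 j) ⟩
  exp 1ℚ j                  ∎

∂-expTrunc : ∀ r j → ∂ (expTrunc r) j ≡ indicator≤ r (suc j) * inv! j
∂-expTrunc r j = begin
  ℕ→ℚ (suc j) * (indicator≤ r (suc j) * inv! (suc j))   ≡⟨ left-comm (ℕ→ℚ (suc j)) (indicator≤ r (suc j)) _ ⟩
  indicator≤ r (suc j) * (ℕ→ℚ (suc j) * inv! (suc j))   ≡⟨ cong (indicator≤ r (suc j) *_) ([1+n]*inv![1+n]≡inv!n j) ⟩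
  indicator≤ r (suc j) * inv! j                           ∎
  where
  left-comm : ∀ a b c → a * (b * c) ≡ b * (a * c)
  left-comm = solve-∀ ℚ-ring

-- ∂ (expTrunc r) is expTrunc r minus its top term t^r/r!.
∂-expTrunc-⋆ : ∀ r n g → r ≤ n → (∂ (expTrunc r) ⋆ g) n ≡ (expTrunc r ⋆ g) n - inv! r * g (n ∸ r)
∂-expTrunc-⋆ r n g r≤n = begin
  (∂ (expTrunc r) ⋆ g) n
    ≡⟨ ⋆-congˡ n g (λ j _ → trans (∂-expTrunc r j) (split (indicator≤ r j) (indicator≤ r (suc j)) (inv! j))) ⟩
  ((λ j → expTrunc r j + - top j) ⋆ g) n
    ≡⟨ ⋆-distribʳ-+ n (expTrunc r) (λ j → - top j) g ⟩
  (expTrunc r ⋆ g) n + ((λ j → - top j) ⋆ g) n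
    ≡⟨ cong ((expTrunc r ⋆ g) n +_) (⋆-negˡ n top g) ⟩
  (expTrunc r ⋆ g) n + - (top ⋆ g) n
    ≡⟨ cong (λ u → (expTrunc r ⋆ g) n + - u) (Σ-single (suc n) r (λ j → top j * g (n ∸ j)) (s≤s r≤n) top-vanishes) ⟩
  (expTrunc r ⋆ g) n + - (top r * g (n ∸ r))
    ≡⟨ cong (λ u → (expTrunc r ⋆ g) n + - (u * g (n ∸ r))) top-at-r ⟩
  (expTrunc r ⋆ g) n - inv! r * g (n ∸ r) ∎
  where
  top : Series
  top j = (indicator≤ r j - indicator≤ r (suc j)) * inv! j
  split : ∀ a b i → b * i ≡ a * i + - ((a - b) * i)
  split = solve-∀ ℚ-ring
  top-vanishes : ∀ j → j < suc n → j ≢ r → top j * g (n ∸ j) ≡ 0ℚ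
  top-vanishes j _ j≢r = begin
    (indicator≤ r j - indicator≤ r (suc j)) * inv! j * g (n ∸ j)  ≡⟨ cong (λ u → (indicator≤ r j - u) * inv! j * g (n ∸ j)) (indicator≤-suc j≢r) ⟩
    (indicator≤ r j - indicator≤ r j) * inv! j * g (n ∸ j)        ≡⟨ cong (λ u → u * inv! j * g (n ∸ j)) (ℚ.+-inverseʳ (indicator≤ r j)) ⟩
    0ℚ * inv! j * g (n ∸ j)                                        ≡⟨ trans (cong (_* g (n ∸ j)) (ℚ.*-zeroˡ (inv! j))) (ℚ.*-zeroˡ (g (n ∸ j))) ⟩
    0ℚ                                                              ∎
  top-at-r : top r ≡ inv! r
  top-at-r = trans (cong₂ (λ a b → (a - b) * inv! r) (indicator≤-≤ (ℕ.≤-refl {r})) (indicator≤-> (ℕ.n<1+n r)))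
                   (ℚ.*-identityˡ (inv! r))

expTrunc-^⋆-≤ : ∀ {r n} y → n ≤ r → (expTrunc r ^⋆ y) n ≡ exp (ℕ→ℚ y) n
expTrunc-^⋆-≤ {r} {n} y n≤r =
  trans (^⋆-cong n (λ j j≤n → expTrunc-≤ (ℕ.≤-trans j≤n n≤r)) y) (exp-1-^⋆ y n)

stirlingSeries : ℕ → ℕ → Series
stirlingSeries r m n = ℕ→ℚ (stirling≤ r n m) * inv! n

-- The summand of the recursion for {n+1, m+1}_{≤r} in which the block of the last element has j further elements.
stirlingTerm : ℕ → ℕ → ℕ → ℕ → ℚ
stirlingTerm r m n j = indicator≤ r (suc j) * (ℕ→ℚ ((n C j) ℕ.* stirling≤ r (n ∸ j) m) * inv! n)

∂-stirlingSeries-suc : ∀ r m n → ∂ (stirlingSeries r (suc m)) n ≡ Σ[ j < r ] stirlingTerm r m n j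
∂-stirlingSeries-suc r m n = begin
  ℕ→ℚ (suc n) * (ℕ→ℚ (sumℕ r block) * inv! (suc n))
    ≡⟨ left-comm (ℕ→ℚ (suc n)) (ℕ→ℚ (sumℕ r block)) (inv! (suc n)) ⟩
  ℕ→ℚ (sumℕ r block) * (ℕ→ℚ (suc n) * inv! (suc n))
    ≡⟨ cong₂ _*_ (sumℕ-Σ r block) ([1+n]*inv![1+n]≡inv!n n) ⟩
  (Σ[ j < r ] ℕ→ℚ (block j)) * inv! n
    ≡⟨ sym (Σ-*ʳ r (inv! n) (ℕ→ℚ ∘ block)) ⟩
  Σ[ j < r ] (ℕ→ℚ (block j) * inv! n)
    ≡⟨ Σ-cong r (λ j j<r → sym (trans (cong (_* (ℕ→ℚ (block j) * inv! n)) (indicator≤-≤ j<r)) (ℚ.*-identityˡ _))) ⟩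
  Σ[ j < r ] stirlingTerm r m n j ∎
  where
  block : ℕ → ℕ
  block j = (n C j) ℕ.* stirling≤ r (n ∸ j) m
  left-comm : ∀ a b c → a * (b * c) ≡ b * (a * c)
  left-comm = solve-∀ ℚ-ring

∂-expTrunc-⋆-stirlingSeries : ∀ r m n → (∂ (expTrunc r) ⋆ stirlingSeries r m) n ≡ Σ[ j < suc n ] stirlingTerm r m n j
∂-expTrunc-⋆-stirlingSeries r m n = Σ-cong (suc n) λ j j<1+n → begin
  ∂ (expTrunc r) j * (T j * inv! (n ∸ j))       ≡⟨ cong (_* (T j * inv! (n ∸ j))) (∂-expTrunc r j) ⟩
  I j * inv! j * (T j * inv! (n ∸ j))           ≡⟨ regroup (I j) (inv! j) (T j) (inv! (n ∸ j)) ⟩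
  I j * (T j * (inv! j * inv! (n ∸ j)))         ≡⟨ cong (λ u → I j * (T j * u)) (sym (nCk*inv!n≡inv!k*inv![n∸k] (ℕ.≤-pred j<1+n))) ⟩
  I j * (T j * (ℕ→ℚ (n C j) * inv! n))          ≡⟨ cong (I j *_) (regroup₂ (T j) (ℕ→ℚ (n C j)) (inv! n)) ⟩
  I j * (ℕ→ℚ (n C j) * T j * inv! n)            ≡⟨ cong (λ u → I j * (u * inv! n)) (sym (ℕ→ℚ-* (n C j) _)) ⟩
  stirlingTerm r m n j                          ∎
  where
  I = λ j → indicator≤ r (suc j)
  T = λ j → ℕ→ℚ (stirling≤ r (n ∸ j) m)
  regroup : ∀ a b c d → a * b * (c * d) ≡ a * (c * (b * d))
  regroup = solve-∀ ℚ-ring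
  regroup₂ : ∀ a b c → a * (b * c) ≡ b * a * c
  regroup₂ = solve-∀ ℚ-ring

∂-stirlingSeries : ∀ r m n → ∂ (stirlingSeries r (suc m)) n ≡ (∂ (expTrunc r) ⋆ stirlingSeries r m) n
∂-stirlingSeries r m n = begin
  ∂ (stirlingSeries r (suc m)) n                 ≡⟨ ∂-stirlingSeries-suc r m n ⟩
  Σ[ j < r ] stirlingTerm r m n j                ≡⟨ Σ-support r (suc n) (stirlingTerm r m n) vanishes-from-r vanishes-beyond-n ⟩
  Σ[ j < suc n ] stirlingTerm r m n j            ≡⟨ sym (∂-expTrunc-⋆-stirlingSeries r m n) ⟩
  (∂ (expTrunc r) ⋆ stirlingSeries r m) n        ∎
  where
  vanishes-from-r : ∀ j → r ≤ j → stirlingTerm r m n j ≡ 0ℚ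
  vanishes-from-r j r≤j = trans (cong (_* rest) (indicator≤-> (s≤s r≤j))) (ℚ.*-zeroˡ rest)
    where
    rest = ℕ→ℚ ((n C j) ℕ.* stirling≤ r (n ∸ j) m) * inv! n
  vanishes-beyond-n : ∀ j → suc n ≤ j → stirlingTerm r m n j ≡ 0ℚ
  vanishes-beyond-n j n<j = begin
    stirlingTerm r m n j                       ≡⟨ cong (λ c → indicator≤ r (suc j) * (ℕ→ℚ (c ℕ.* stirling≤ r (n ∸ j) m) * inv! n)) (k>n⇒nCk≡0 n<j) ⟩
    indicator≤ r (suc j) * (0ℚ * inv! n)       ≡⟨ cong (indicator≤ r (suc j) *_) (ℚ.*-zeroˡ (inv! n)) ⟩
    indicator≤ r (suc j) * 0ℚ                  ≡⟨ ℚ.*-zeroʳ (indicator≤ r (suc j)) ⟩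
    0ℚ                                         ∎

∂-stirlingSeries-0 : ∀ r n → ∂ (stirlingSeries r 0) n ≡ 0ℚ
∂-stirlingSeries-0 r n = trans (cong (ℕ→ℚ (suc n) *_) (ℚ.*-zeroˡ (inv! (suc n)))) (ℚ.*-zeroʳ (ℕ→ℚ (suc n)))

falling : ℕ → ℕ → ℚ
falling y m = ℕ→ℚ (y !) * inv! (y ∸ m)

falling-suc : ∀ y m → falling (suc y) (suc m) ≡ ℕ→ℚ (suc y) * falling y m
falling-suc y m = trans (cong (_* inv! (y ∸ m)) (ℕ→ℚ-* (suc y) (y !))) (ℚ.*-assoc (ℕ→ℚ (suc y)) _ _)

stirlingSum : ℕ → ℕ → Series
stirlingSum r y n = Σ[ m < suc y ] (falling y m * stirlingSeries r m n)

∂-stirlingSum : ∀ r y n → ∂ (stirlingSum r (suc y)) n ≡ ℕ→ℚ (suc y) * (∂ (expTrunc r) ⋆ stirlingSum r y) n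
∂-stirlingSum r y n = begin
  ℕ→ℚ (suc n) * (Σ[ m < suc (suc y) ] (falling (suc y) m * S m (suc n)))
    ≡⟨ sym (Σ-*ˡ (suc (suc y)) (ℕ→ℚ (suc n)) (λ m → falling (suc y) m * S m (suc n))) ⟩
  Σ[ m < suc (suc y) ] (ℕ→ℚ (suc n) * (falling (suc y) m * S m (suc n)))
    ≡⟨ Σ-cong (suc (suc y)) (λ m _ → left-comm (ℕ→ℚ (suc n)) (falling (suc y) m) (S m (suc n))) ⟩
  Σ[ m < suc (suc y) ] (falling (suc y) m * ∂ (S m) n)
    ≡⟨ cong₂ _+_ (trans (cong (falling (suc y) 0 *_) (∂-stirlingSeries-0 r n)) (ℚ.*-zeroʳ (falling (suc y) 0)))
                 (Σ-cong (suc y) (λ m _ → term m)) ⟩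
  0ℚ + Σ[ m < suc y ] (ℕ→ℚ (suc y) * (∂ ê ⋆ weighted m) n)
    ≡⟨ ℚ.+-identityˡ _ ⟩
  Σ[ m < suc y ] (ℕ→ℚ (suc y) * (∂ ê ⋆ weighted m) n)
    ≡⟨ Σ-*ˡ (suc y) (ℕ→ℚ (suc y)) (λ m → (∂ ê ⋆ weighted m) n) ⟩
  ℕ→ℚ (suc y) * (Σ[ m < suc y ] (∂ ê ⋆ weighted m) n)
    ≡⟨ cong (ℕ→ℚ (suc y) *_) (sym (⋆-Σʳ n (suc y) (∂ ê) weighted)) ⟩
  ℕ→ℚ (suc y) * (∂ ê ⋆ stirlingSum r y) n ∎
  where
  S = stirlingSeries r
  ê = expTrunc r
  weighted : ℕ → Series
  weighted m k = falling y m * S m k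
  left-comm : ∀ a b c → a * (b * c) ≡ b * (a * c)
  left-comm = solve-∀ ℚ-ring
  term : ∀ m → falling (suc y) (suc m) * ∂ (S (suc m)) n ≡ ℕ→ℚ (suc y) * (∂ ê ⋆ weighted m) n
  term m = begin
    falling (suc y) (suc m) * ∂ (S (suc m)) n        ≡⟨ cong₂ _*_ (falling-suc y m) (∂-stirlingSeries r m n) ⟩
    ℕ→ℚ (suc y) * falling y m * (∂ ê ⋆ S m) n        ≡⟨ ℚ.*-assoc (ℕ→ℚ (suc y)) _ _ ⟩
    ℕ→ℚ (suc y) * (falling y m * (∂ ê ⋆ S m) n)      ≡⟨ cong (ℕ→ℚ (suc y) *_) (sym (⋆-scaleʳ n (falling y m) (∂ ê) (S m))) ⟩
    ℕ→ℚ (suc y) * (∂ ê ⋆ weighted m) n               ∎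

stirlingSum-at-0 : ∀ r y → stirlingSum r y 0 ≡ 1ℚ
stirlingSum-at-0 r y = begin
  falling y 0 * (1ℚ * 1ℚ) + Σ[ m < y ] (falling y (suc m) * 0ℚ)
    ≡⟨ cong₂ _+_ (ℚ.*-identityʳ (falling y 0)) (Σ-zero y (λ m _ → ℚ.*-zeroʳ (falling y (suc m)))) ⟩
  ℕ→ℚ (y !) * inv! y + 0ℚ   ≡⟨ ℚ.+-identityʳ _ ⟩
  ℕ→ℚ (y !) * inv! y        ≡⟨ ℚ.*-comm (ℕ→ℚ (y !)) (inv! y) ⟩
  inv! y * ℕ→ℚ (y !)        ≡⟨ inv!*n!≡1 y ⟩
  1ℚ                        ∎

stirlingSum-0 : ∀ r n → stirlingSum r 0 n ≡ δ n
stirlingSum-0 r zero    = refl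
stirlingSum-0 r (suc n) = trans (cong (λ u → 1ℚ * u + 0ℚ) (ℚ.*-zeroˡ (inv! (suc n)))) refl

stirlingSum≡expTrunc^⋆ : ∀ r y n → stirlingSum r y n ≡ (expTrunc r ^⋆ y) n
stirlingSum≡expTrunc^⋆ r zero    = stirlingSum-0 r
stirlingSum≡expTrunc^⋆ r (suc y) =
  ∂-unique (trans (stirlingSum-at-0 r (suc y)) (sym (^⋆-at-0 {expTrunc r} refl (suc y)))) λ n _ → begin
    ∂ (stirlingSum r (suc y)) n                          ≡⟨ ∂-stirlingSum r y n ⟩
    ℕ→ℚ (suc y) * (∂ (expTrunc r) ⋆ stirlingSum r y) n   ≡⟨ cong (ℕ→ℚ (suc y) *_) (⋆-congʳ n (∂ (expTrunc r)) (λ j _ → stirlingSum≡expTrunc^⋆ r y j)) ⟩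
    ℕ→ℚ (suc y) * (∂ (expTrunc r) ⋆ expTrunc r ^⋆ y) n   ≡⟨ sym (∂-^⋆ y n (expTrunc r)) ⟩
    ∂ (expTrunc r ^⋆ suc y) n                            ∎

⋆-shiftʳ : ∀ n f g → (f ⋆ (g ∘ suc)) n ≡ (f ⋆ g) (suc n) - f (suc n) * g 0
⋆-shiftʳ n f g = begin
  (f ⋆ (g ∘ suc)) n
    ≡⟨ Σ-cong (suc n) (λ j j<1+n → cong (λ i → f j * g i) (sym (ℕ.+-∸-assoc 1 (ℕ.≤-pred j<1+n)))) ⟩
  Σ[ j < suc n ] (f j * g (suc n ∸ j))
    ≡⟨ add-and-subtract _ (f (suc n) * g (suc n ∸ suc n)) ⟩
  Σ[ j < suc n ] (f j * g (suc n ∸ j)) + f (suc n) * g (suc n ∸ suc n) - f (suc n) * g (suc n ∸ suc n)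
    ≡⟨ cong₂ _-_ (sym (Σ-suc (suc n) (λ j → f j * g (suc n ∸ j)))) (cong (λ i → f (suc n) * g i) (ℕ.n∸n≡0 n)) ⟩
  (f ⋆ g) (suc n) - f (suc n) * g 0 ∎
  where
  add-and-subtract : ∀ a b → a ≡ a + b - b
  add-and-subtract = solve-∀ ℚ-ring

H-suc : ∀ n → H (suc n) ≡ H n + recip (suc n)
H-suc n = trans (sumFrom-1 (suc n) recip) (trans (Σ-suc n (recip ∘ suc)) (cong (_+ recip (suc n)) (sym (sumFrom-1 n recip))))

inv!*recip : ∀ n → inv! n * recip (suc n) ≡ inv! (suc n)
inv!*recip n = begin
  inv! n * recip (suc n)                             ≡⟨ cong (_* recip (suc n)) (sym ([1+n]*inv![1+n]≡inv!n n)) ⟩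
  ℕ→ℚ (suc n) * inv! (suc n) * recip (suc n)         ≡⟨ regroup (ℕ→ℚ (suc n)) (inv! (suc n)) (recip (suc n)) ⟩
  inv! (suc n) * (recip (suc n) * ℕ→ℚ (suc n))       ≡⟨ cong (inv! (suc n) *_) (1/n*n≡1 (suc n)) ⟩
  inv! (suc n) * 1ℚ                                  ≡⟨ ℚ.*-identityʳ _ ⟩
  inv! (suc n)                                       ∎
  where
  regroup : ∀ s i c → s * i * c ≡ i * (c * s)
  regroup = solve-∀ ℚ-ring

alternating : Series
alternating i = (- 1ℚ) ^ i * recip i * inv! i

∂-alternating : ∀ j → ∂ alternating j ≡ exp (- 1ℚ) (suc j)
∂-alternating j = begin
  ℕ→ℚ (suc j) * (s * recip (suc j) * inv! (suc j))   ≡⟨ regroup (ℕ→ℚ (suc j)) s (recip (suc j)) (inv! (suc j)) ⟩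
  s * inv! (suc j) * (recip (suc j) * ℕ→ℚ (suc j))   ≡⟨ cong (s * inv! (suc j) *_) (1/n*n≡1 (suc j)) ⟩
  s * inv! (suc j) * 1ℚ                              ≡⟨ ℚ.*-identityʳ _ ⟩
  exp (- 1ℚ) (suc j)                                 ∎
  where
  s = (- 1ℚ) ^ suc j
  regroup : ∀ n s c i → n * (s * c * i) ≡ s * i * (c * n)
  regroup = solve-∀ ℚ-ring

exp-1-⋆-alternating : ∀ k → (exp 1ℚ ⋆ alternating) k ≡ - (inv! k * H k)
exp-1-⋆-alternating = ∂-unique refl step
  where
  step : ∀ n → (exp 1ℚ ⋆ alternating) n ≡ - (inv! n * H n) →
         ∂ (exp 1ℚ ⋆ alternating) n ≡ ∂ (λ k → - (inv! k * H k)) n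
  step n hyp = begin
    ∂ (exp 1ℚ ⋆ alternating) n
      ≡⟨ ∂-⋆ n (exp 1ℚ) alternating ⟩
    (∂ (exp 1ℚ) ⋆ alternating) n + (exp 1ℚ ⋆ ∂ alternating) n
      ≡⟨ cong₂ _+_ (⋆-congˡ n alternating (λ j _ → trans (∂-exp 1ℚ j) (ℚ.*-identityˡ (exp 1ℚ j))))
                   (⋆-congʳ n (exp 1ℚ) (λ j _ → ∂-alternating j)) ⟩
    (exp 1ℚ ⋆ alternating) n + (exp 1ℚ ⋆ (exp (- 1ℚ) ∘ suc)) n
      ≡⟨ cong₂ _+_ hyp (⋆-shiftʳ n (exp 1ℚ) (exp (- 1ℚ))) ⟩
    - (inv! n * H n) + ((exp 1ℚ ⋆ exp (- 1ℚ)) (suc n) - exp 1ℚ (suc n) * 1ℚ)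
      ≡⟨ cong₂ (λ u v → - (inv! n * H n) + (u - v)) (trans (exp-⋆ 1ℚ (- 1ℚ) (suc n)) (exp-0 (suc n)))
                                                     (trans (ℚ.*-identityʳ _) (exp-1 (suc n))) ⟩
    - (inv! n * H n) + (0ℚ - inv! (suc n))
      ≡⟨ cong (λ u → - (inv! n * H n) + (0ℚ - u)) (sym (inv!*recip n)) ⟩
    - (inv! n * H n) + (0ℚ - inv! n * recip (suc n))
      ≡⟨ collect (inv! n) (H n) (recip (suc n)) ⟩
    - (inv! n * (H n + recip (suc n)))
      ≡⟨ cong₂ (λ u v → - (u * v)) (sym ([1+n]*inv![1+n]≡inv!n n)) (sym (H-suc n)) ⟩
    - (ℕ→ℚ (suc n) * inv! (suc n) * H (suc n))
      ≡⟨ neg-assoc (ℕ→ℚ (suc n)) (inv! (suc n)) (H (suc n)) ⟩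
    ∂ (λ k → - (inv! k * H k)) n ∎
    where
    collect : ∀ i h c → - (i * h) + (0ℚ - i * c) ≡ - (i * (h + c))
    collect = solve-∀ ℚ-ring
    neg-assoc : ∀ s i h → - (s * i * h) ≡ s * - (i * h)
    neg-assoc = solve-∀ ℚ-ring

harmonic-identity : ∀ k → Σ[ j < k ] (inv! (k ∸ suc j) * alternating (suc j)) ≡ - (inv! k * H k)
harmonic-identity k = begin
  Σ[ j < k ] (inv! (k ∸ suc j) * alternating (suc j))
    ≡⟨ sym (ℚ.+-identityˡ _) ⟩
  0ℚ + Σ[ j < k ] (inv! (k ∸ suc j) * alternating (suc j))
    ≡⟨ cong₂ _+_ (sym (ℚ.*-zeroˡ (exp 1ℚ k)))
                 (Σ-cong k (λ j _ → trans (ℚ.*-comm (inv! (k ∸ suc j)) (alternating (suc j))) (cong (alternating (suc j) *_) (sym (exp-1 (k ∸ suc j)))))) ⟩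
  (alternating ⋆ exp 1ℚ) k
    ≡⟨ ⋆-comm k alternating (exp 1ℚ) ⟩
  (exp 1ℚ ⋆ alternating) k
    ≡⟨ exp-1-⋆-alternating k ⟩
  - (inv! k * H k) ∎

signedBinomial : ℕ → ℕ → ℚ
signedBinomial n j = ℕ→ℚ (n C j) * (- 1ℚ) ^ (n ∸ j)

signedBinomial-0 : ∀ n → signedBinomial (suc n) 0 ≡ - signedBinomial n 0
signedBinomial-0 n = neg-one-factor ((- 1ℚ) ^ n)
  where
  neg-one-factor : ∀ s → 1ℚ * (- 1ℚ * s) ≡ - (1ℚ * s)
  neg-one-factor = solve-∀ ℚ-ring

signedBinomial-pascal : ∀ n j → signedBinomial (suc n) (suc j) ≡ signedBinomial n j - signedBinomial n (suc j)
signedBinomial-pascal n j with j ℕ.<? n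
... | yes j<n = begin
  ℕ→ℚ (suc n C suc j) * (- 1ℚ) ^ (n ∸ j)
    ≡⟨ cong₂ (λ c e → ℕ→ℚ c * (- 1ℚ) ^ e) (sym (nCk+nC[k+1]≡[n+1]C[k+1] n j)) (ℕ.+-∸-assoc 1 j<n) ⟩
  ℕ→ℚ (n C j ℕ.+ n C suc j) * (- 1ℚ * (- 1ℚ) ^ (n ∸ suc j))
    ≡⟨ cong (_* (- 1ℚ * (- 1ℚ) ^ (n ∸ suc j))) (ℕ→ℚ-+ (n C j) (n C suc j)) ⟩
  (ℕ→ℚ (n C j) + ℕ→ℚ (n C suc j)) * (- 1ℚ * (- 1ℚ) ^ (n ∸ suc j))
    ≡⟨ expand (ℕ→ℚ (n C j)) (ℕ→ℚ (n C suc j)) ((- 1ℚ) ^ (n ∸ suc j)) ⟩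
  ℕ→ℚ (n C j) * (- 1ℚ * (- 1ℚ) ^ (n ∸ suc j)) - ℕ→ℚ (n C suc j) * (- 1ℚ) ^ (n ∸ suc j)
    ≡⟨ cong (λ e → ℕ→ℚ (n C j) * (- 1ℚ) ^ e - signedBinomial n (suc j)) (sym (ℕ.+-∸-assoc 1 j<n)) ⟩
  signedBinomial n j - signedBinomial n (suc j) ∎
  where
  expand : ∀ a b s → (a + b) * (- 1ℚ * s) ≡ a * (- 1ℚ * s) - b * s
  expand = solve-∀ ℚ-ring
... | no j≮n = begin
  ℕ→ℚ (suc n C suc j) * (- 1ℚ) ^ (n ∸ j)
    ≡⟨ cong (λ c → ℕ→ℚ c * (- 1ℚ) ^ (n ∸ j)) (sym (nCk+nC[k+1]≡[n+1]C[k+1] n j)) ⟩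
  ℕ→ℚ (n C j ℕ.+ n C suc j) * (- 1ℚ) ^ (n ∸ j)
    ≡⟨ cong (λ c → ℕ→ℚ (n C j ℕ.+ c) * (- 1ℚ) ^ (n ∸ j)) (k>n⇒nCk≡0 (s≤s n≤j)) ⟩
  ℕ→ℚ (n C j ℕ.+ 0) * (- 1ℚ) ^ (n ∸ j)
    ≡⟨ cong (λ c → ℕ→ℚ c * (- 1ℚ) ^ (n ∸ j)) (ℕ.+-identityʳ (n C j)) ⟩
  signedBinomial n j
    ≡⟨ sym (ℚ.+-identityʳ _) ⟩
  signedBinomial n j + - 0ℚ
    ≡⟨ cong (λ z → signedBinomial n j - z) (sym (ℚ.*-zeroˡ ((- 1ℚ) ^ (n ∸ suc j)))) ⟩
  signedBinomial n j - 0ℚ * (- 1ℚ) ^ (n ∸ suc j)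
    ≡⟨ cong (λ c → signedBinomial n j - ℕ→ℚ c * (- 1ℚ) ^ (n ∸ suc j)) (sym (k>n⇒nCk≡0 (s≤s n≤j))) ⟩
  signedBinomial n j - signedBinomial n (suc j) ∎
  where
  n≤j : n ≤ j
  n≤j = ℕ.≮⇒≥ j≮n

Σ-signedBinomial-suc : ∀ n (e : ℕ → ℚ) →
  Σ[ j < suc (suc n) ] (signedBinomial (suc n) j * e j) ≡
  Σ[ j < suc n ] (signedBinomial n j * e (suc j)) - Σ[ j < suc n ] (signedBinomial n j * e j)
Σ-signedBinomial-suc n e = begin
  signedBinomial (suc n) 0 * e 0 + Σ[ j < suc n ] (signedBinomial (suc n) (suc j) * e (suc j))
    ≡⟨ cong₂ _+_ (cong (_* e 0) (signedBinomial-0 n)) (Σ-cong (suc n) (λ j _ → pascal-term j)) ⟩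
  - c 0 * e 0 + Σ[ j < suc n ] (c j * e (suc j) + - (c (suc j) * e (suc j)))
    ≡⟨ cong (- c 0 * e 0 +_) (trans (Σ-+ (suc n) (λ j → c j * e (suc j)) (λ j → - (c (suc j) * e (suc j)))) (cong (A +_) (Σ-neg (suc n) (λ j → c (suc j) * e (suc j))))) ⟩
  - c 0 * e 0 + (A + - (Σ[ j < suc n ] (c (suc j) * e (suc j))))
    ≡⟨ cong (λ u → - c 0 * e 0 + (A + - u)) top-term-vanishes ⟩
  - c 0 * e 0 + (A + - (Σ[ j < n ] (c (suc j) * e (suc j))))
    ≡⟨ rearrange (c 0) (e 0) A _ ⟩
  A - Σ[ j < suc n ] (c j * e j) ∎
  where
  c = signedBinomial n
  A = Σ[ j < suc n ] (c j * e (suc j))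
  pascal-term : ∀ j → signedBinomial (suc n) (suc j) * e (suc j) ≡ c j * e (suc j) + - (c (suc j) * e (suc j))
  pascal-term j = trans (cong (_* e (suc j)) (signedBinomial-pascal n j))
                        (trans (ℚ.*-distribʳ-+ (e (suc j)) (c j) (- c (suc j)))
                               (cong (c j * e (suc j) +_) (sym (ℚ.neg-distribˡ-* (c (suc j)) (e (suc j))))))
  top-term-vanishes : Σ[ j < suc n ] (c (suc j) * e (suc j)) ≡ Σ[ j < n ] (c (suc j) * e (suc j))
  top-term-vanishes = begin
    Σ[ j < suc n ] (c (suc j) * e (suc j))                        ≡⟨ Σ-suc n (λ j → c (suc j) * e (suc j)) ⟩
    Σ[ j < n ] (c (suc j) * e (suc j)) + c (suc n) * e (suc n)     ≡⟨ cong (λ b → Σ[ j < n ] (c (suc j) * e (suc j)) + ℕ→ℚ b * (- 1ℚ) ^ (n ∸ suc n) * e (suc n)) (k>n⇒nCk≡0 (ℕ.n<1+n n)) ⟩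
    Σ[ j < n ] (c (suc j) * e (suc j)) + 0ℚ * (- 1ℚ) ^ (n ∸ suc n) * e (suc n)
      ≡⟨ cong (Σ[ j < n ] (c (suc j) * e (suc j)) +_) (trans (cong (_* e (suc n)) (ℚ.*-zeroˡ ((- 1ℚ) ^ (n ∸ suc n)))) (ℚ.*-zeroˡ (e (suc n)))) ⟩
    Σ[ j < n ] (c (suc j) * e (suc j)) + 0ℚ                        ≡⟨ ℚ.+-identityʳ _ ⟩
    Σ[ j < n ] (c (suc j) * e (suc j))                             ∎
  rearrange : ∀ a b A X → - a * b + (A + - X) ≡ A - (a * b + X)
  rearrange = solve-∀ ℚ-ring

expMinus1 : Series
expMinus1 j = exp 1ℚ j - δ j

expMinus1-⋆ : ∀ n g → (expMinus1 ⋆ g) n ≡ (exp 1ℚ ⋆ g) n - g n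
expMinus1-⋆ n g = begin
  (expMinus1 ⋆ g) n                              ≡⟨ ⋆-distribʳ-+ n (exp 1ℚ) (λ j → - δ j) g ⟩
  (exp 1ℚ ⋆ g) n + ((λ j → - δ j) ⋆ g) n          ≡⟨ cong ((exp 1ℚ ⋆ g) n +_) (trans (⋆-negˡ n δ g) (cong -_ (⋆-identityˡ n g))) ⟩
  (exp 1ℚ ⋆ g) n - g n                           ∎

expMinus1-^⋆ : ∀ n m → (expMinus1 ^⋆ n) m ≡ Σ[ j < suc n ] (signedBinomial n j * exp (ℕ→ℚ j) m)
expMinus1-^⋆ zero    m = sym (trans (ℚ.+-identityʳ _) (trans (ℚ.*-identityˡ _) (exp-0 m)))
expMinus1-^⋆ (suc n) m = begin
  (expMinus1 ⋆ expMinus1 ^⋆ n) m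
    ≡⟨ expMinus1-⋆ m (expMinus1 ^⋆ n) ⟩
  (exp 1ℚ ⋆ expMinus1 ^⋆ n) m - (expMinus1 ^⋆ n) m
    ≡⟨ cong₂ _-_ (⋆-congʳ m (exp 1ℚ) (λ k _ → expMinus1-^⋆ n k)) (expMinus1-^⋆ n m) ⟩
  (exp 1ℚ ⋆ (λ k → Σ[ j < suc n ] (c j * exp (ℕ→ℚ j) k))) m - Σ[ j < suc n ] (c j * exp (ℕ→ℚ j) m)
    ≡⟨ cong (_- Σ[ j < suc n ] (c j * exp (ℕ→ℚ j) m)) (trans (⋆-Σʳ m (suc n) (exp 1ℚ) (λ j k → c j * exp (ℕ→ℚ j) k))
                                                             (Σ-cong (suc n) (λ j _ → shifted j))) ⟩
  Σ[ j < suc n ] (c j * exp (ℕ→ℚ (suc j)) m) - Σ[ j < suc n ] (c j * exp (ℕ→ℚ j) m)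
    ≡⟨ sym (Σ-signedBinomial-suc n (λ j → exp (ℕ→ℚ j) m)) ⟩
  Σ[ j < suc (suc n) ] (signedBinomial (suc n) j * exp (ℕ→ℚ j) m) ∎
  where
  c = signedBinomial n
  shifted : ∀ j → (exp 1ℚ ⋆ (λ k → c j * exp (ℕ→ℚ j) k)) m ≡ c j * exp (ℕ→ℚ (suc j)) m
  shifted j = begin
    (exp 1ℚ ⋆ (λ k → c j * exp (ℕ→ℚ j) k)) m   ≡⟨ ⋆-scaleʳ m (c j) (exp 1ℚ) (exp (ℕ→ℚ j)) ⟩
    c j * (exp 1ℚ ⋆ exp (ℕ→ℚ j)) m             ≡⟨ cong (c j *_) (exp-⋆ 1ℚ (ℕ→ℚ j) m) ⟩
    c j * exp (1ℚ + ℕ→ℚ j) m                    ≡⟨ cong (λ a → c j * exp a m) (sym (ℕ→ℚ-suc j)) ⟩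
    c j * exp (ℕ→ℚ (suc j)) m                   ∎

Σ-signedBinomial-pow : ∀ n → Σ[ j < suc n ] (signedBinomial n j * ℕ→ℚ j ^ n) ≡ ℕ→ℚ (n !)
Σ-signedBinomial-pow n = begin
  Σ[ j < suc n ] (signedBinomial n j * ℕ→ℚ j ^ n)
    ≡⟨ Σ-cong (suc n) (λ j _ → clear-denominator (signedBinomial n j) (ℕ→ℚ j ^ n)) ⟩
  Σ[ j < suc n ] (ℕ→ℚ (n !) * (signedBinomial n j * exp (ℕ→ℚ j) n))
    ≡⟨ Σ-*ˡ (suc n) (ℕ→ℚ (n !)) (λ j → signedBinomial n j * exp (ℕ→ℚ j) n) ⟩
  ℕ→ℚ (n !) * (Σ[ j < suc n ] (signedBinomial n j * exp (ℕ→ℚ j) n))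
    ≡⟨ cong (ℕ→ℚ (n !) *_) (sym (expMinus1-^⋆ n n)) ⟩
  ℕ→ℚ (n !) * (expMinus1 ^⋆ n) n
    ≡⟨ cong (ℕ→ℚ (n !) *_) (^⋆-diagonal {expMinus1} refl refl n) ⟩
  ℕ→ℚ (n !) * 1ℚ
    ≡⟨ ℚ.*-identityʳ _ ⟩
  ℕ→ℚ (n !) ∎
  where
  regroup : ∀ F c x i → F * (c * (x * i)) ≡ c * x * (i * F)
  regroup = solve-∀ ℚ-ring
  clear-denominator : ∀ c x → c * x ≡ ℕ→ℚ (n !) * (c * (x * inv! n))
  clear-denominator c x = sym (trans (regroup (ℕ→ℚ (n !)) c x (inv! n))
    (trans (cong (c * x *_) (inv!*n!≡1 n)) (ℚ.*-identityʳ (c * x))))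

Σ-signedBinomial : ∀ n → 0 < n → Σ[ j < suc n ] signedBinomial n j ≡ 0ℚ
Σ-signedBinomial n 0<n = begin
  Σ[ j < suc n ] signedBinomial n j                    ≡⟨ Σ-cong (suc n) (λ j _ → sym (ℚ.*-identityʳ (signedBinomial n j))) ⟩
  Σ[ j < suc n ] (signedBinomial n j * exp (ℕ→ℚ j) 0)  ≡⟨ sym (expMinus1-^⋆ n 0) ⟩
  (expMinus1 ^⋆ n) 0                                   ≡⟨ ^⋆-below {expMinus1} refl n 0 0<n ⟩
  0ℚ                                                   ∎

∂-expTrunc-^⋆ : ∀ r y n → r ≤ n →
  ∂ (expTrunc r ^⋆ suc y) n ≡ ℕ→ℚ (suc y) * ((expTrunc r ^⋆ suc y) n - inv! r * (expTrunc r ^⋆ y) (n ∸ r))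
∂-expTrunc-^⋆ r y n r≤n =
  trans (∂-^⋆ y n (expTrunc r)) (cong (ℕ→ℚ (suc y) *_) (∂-expTrunc-⋆ r n (expTrunc r ^⋆ y) r≤n))

innerSum : ℕ → ℕ → ℚ
innerSum p i = sumFrom 1 p (λ m →
  ℕ→ℚ ((p ∸ 1) !) * inv! (p ∸ m) * inv! (i ℕ.+ p) * ℕ→ℚ (stirling≤ (p ∸ 1) (i ℕ.+ p) m))

p*innerSum : ∀ r i → ℕ→ℚ (suc r) * innerSum (suc r) i ≡ (expTrunc r ^⋆ suc r) (i ℕ.+ suc r)
p*innerSum r i = begin
  ℕ→ℚ p * innerSum p i                                  ≡⟨ cong (ℕ→ℚ p *_) (sumFrom-1 p summand) ⟩
  ℕ→ℚ p * (Σ[ m < p ] summand (suc m))                  ≡⟨ sym (Σ-*ˡ p (ℕ→ℚ p) (summand ∘ suc)) ⟩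
  Σ[ m < p ] (ℕ→ℚ p * summand (suc m))                  ≡⟨ Σ-cong p (λ m _ → as-falling (suc m)) ⟩
  Σ[ m < p ] (falling p (suc m) * stirlingSeries r (suc m) N)
    ≡⟨ sym (trans (cong (_+ Σ[ m < p ] (falling p (suc m) * stirlingSeries r (suc m) N)) no-empty-partition) (ℚ.+-identityˡ _)) ⟩
  stirlingSum r p N                                     ≡⟨ stirlingSum≡expTrunc^⋆ r p N ⟩
  (expTrunc r ^⋆ p) N                                   ∎
  where
  p = suc r
  N = i ℕ.+ p
  summand : ℕ → ℚ
  summand m = ℕ→ℚ (r !) * inv! (p ∸ m) * inv! N * ℕ→ℚ (stirling≤ r N m)
  regroup : ∀ P R a b c → P * (R * a * b * c) ≡ P * R * a * (c * b)
  regroup = solve-∀ ℚ-ring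
  as-falling : ∀ m → ℕ→ℚ p * summand m ≡ falling p m * stirlingSeries r m N
  as-falling m = trans (regroup (ℕ→ℚ p) (ℕ→ℚ (r !)) (inv! (p ∸ m)) (inv! N) (ℕ→ℚ (stirling≤ r N m)))
    (cong (λ u → u * inv! (p ∸ m) * stirlingSeries r m N) (sym (ℕ→ℚ-* p (r !))))
  no-empty-partition : falling p 0 * stirlingSeries r 0 N ≡ 0ℚ
  no-empty-partition = begin
    falling p 0 * (ℕ→ℚ (stirling≤ r N 0) * inv! N)         ≡⟨ cong (λ n → falling p 0 * (ℕ→ℚ (stirling≤ r n 0) * inv! N)) (ℕ.+-suc i r) ⟩
    falling p 0 * (0ℚ * inv! N)                             ≡⟨ cong (falling p 0 *_) (ℚ.*-zeroˡ (inv! N)) ⟩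
    falling p 0 * 0ℚ                                        ≡⟨ ℚ.*-zeroʳ (falling p 0) ⟩
    0ℚ                                                      ∎

innerSum-recurrence : ∀ r i →
  ℕ→ℚ (suc i ℕ.+ suc r) * innerSum (suc r) (suc i) ≡ (expTrunc r ^⋆ suc r) (i ℕ.+ suc r) - inv! r * (expTrunc r ^⋆ r) (suc i)
innerSum-recurrence r i = ℕ→ℚ-cancelˡ (suc r) (begin
  ℕ→ℚ p * (ℕ→ℚ (suc n) * innerSum p (suc i))      ≡⟨ left-comm (ℕ→ℚ p) (ℕ→ℚ (suc n)) (innerSum p (suc i)) ⟩
  ℕ→ℚ (suc n) * (ℕ→ℚ p * innerSum p (suc i))      ≡⟨ cong (ℕ→ℚ (suc n) *_) (p*innerSum r (suc i)) ⟩
  ∂ (expTrunc r ^⋆ p) n                           ≡⟨ ∂-expTrunc-^⋆ r r n r≤n ⟩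
  ℕ→ℚ p * ((expTrunc r ^⋆ p) n - inv! r * (expTrunc r ^⋆ r) (n ∸ r))
    ≡⟨ cong (λ m → ℕ→ℚ p * ((expTrunc r ^⋆ p) n - inv! r * (expTrunc r ^⋆ r) m)) n∸r≡1+i ⟩
  ℕ→ℚ p * ((expTrunc r ^⋆ p) n - inv! r * (expTrunc r ^⋆ r) (suc i)) ∎)
  where
  p = suc r
  n = i ℕ.+ p
  r≤n : r ≤ n
  r≤n = ℕ.≤-trans (ℕ.n≤1+n r) (ℕ.m≤n+m p i)
  n∸r≡1+i : n ∸ r ≡ suc i
  n∸r≡1+i = trans (cong (_∸ r) (ℕ.+-suc i r)) (ℕ.m+n∸n≡m (suc i) r)
  left-comm : ∀ a b c → a * (b * c) ≡ b * (a * c)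
  left-comm = solve-∀ ℚ-ring

expTrunc^⋆p-at-p : ∀ r → (expTrunc r ^⋆ suc r) (suc r) ≡ ℕ→ℚ (suc r) ^ r * inv! r - inv! r
expTrunc^⋆p-at-p r = ℕ→ℚ-cancelˡ (suc r) (begin
  ∂ (expTrunc r ^⋆ suc r) r
    ≡⟨ ∂-expTrunc-^⋆ r r r ℕ.≤-refl ⟩
  ℕ→ℚ (suc r) * ((expTrunc r ^⋆ suc r) r - inv! r * (expTrunc r ^⋆ r) (r ∸ r))
    ≡⟨ cong₂ (λ u v → ℕ→ℚ (suc r) * (u - inv! r * v)) (expTrunc-^⋆-≤ (suc r) ℕ.≤-refl)
                                                       (trans (cong (expTrunc r ^⋆ r) (ℕ.n∸n≡0 r)) (^⋆-at-0 {expTrunc r} refl r)) ⟩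
  ℕ→ℚ (suc r) * (ℕ→ℚ (suc r) ^ r * inv! r - inv! r * 1ℚ)
    ≡⟨ cong (λ u → ℕ→ℚ (suc r) * (ℕ→ℚ (suc r) ^ r * inv! r - u)) (ℚ.*-identityʳ (inv! r)) ⟩
  ℕ→ℚ (suc r) * (ℕ→ℚ (suc r) ^ r * inv! r - inv! r) ∎)

binomial-ends : ∀ r a b →
  (a + b) ^ suc r ≡ a ^ suc r + b ^ suc r + ℕ→ℚ (suc r !) * (Σ[ j < r ] (exp a (suc j) * exp b (r ∸ j)))
binomial-ends r a b = begin
  (a + b) ^ p
    ≡⟨ sym (clear (ℕ→ℚ (p !)) ((a + b) ^ p) (inv! p) (inv!*n!≡1 p)) ⟩
  ℕ→ℚ (p !) * exp (a + b) p
    ≡⟨ cong (ℕ→ℚ (p !) *_) (sym (exp-⋆ a b p)) ⟩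
  ℕ→ℚ (p !) * (exp a 0 * exp b p + Σ[ j < p ] (exp a (suc j) * exp b (r ∸ j)))
    ≡⟨ cong (λ s → ℕ→ℚ (p !) * (exp a 0 * exp b p + s)) (Σ-suc r (λ j → exp a (suc j) * exp b (r ∸ j))) ⟩
  ℕ→ℚ (p !) * (exp a 0 * exp b p + (M + exp a p * exp b (r ∸ r)))
    ≡⟨ cong (λ m → ℕ→ℚ (p !) * (exp a 0 * exp b p + (M + exp a p * exp b m))) (ℕ.n∸n≡0 r) ⟩
  ℕ→ℚ (p !) * (1ℚ * 1ℚ * (b ^ p * inv! p) + (M + a ^ p * inv! p * (1ℚ * 1ℚ)))
    ≡⟨ expand (ℕ→ℚ (p !)) (inv! p) (a ^ p) (b ^ p) M ⟩
  inv! p * ℕ→ℚ (p !) * a ^ p + inv! p * ℕ→ℚ (p !) * b ^ p + ℕ→ℚ (p !) * M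
    ≡⟨ cong (λ u → u * a ^ p + u * b ^ p + ℕ→ℚ (p !) * M) (inv!*n!≡1 p) ⟩
  1ℚ * a ^ p + 1ℚ * b ^ p + ℕ→ℚ (p !) * M
    ≡⟨ cong₂ (λ u v → u + v + ℕ→ℚ (p !) * M) (ℚ.*-identityˡ (a ^ p)) (ℚ.*-identityˡ (b ^ p)) ⟩
  a ^ p + b ^ p + ℕ→ℚ (p !) * M ∎
  where
  p = suc r
  M = Σ[ j < r ] (exp a (suc j) * exp b (r ∸ j))
  clear : ∀ F x I → I * F ≡ 1ℚ → F * (x * I) ≡ x
  clear F x I I*F≡1 = trans (regroup F x I) (trans (cong (x *_) I*F≡1) (ℚ.*-identityʳ x))
    where
    regroup : ∀ F x I → F * (x * I) ≡ x * (I * F)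
    regroup = solve-∀ ℚ-ring
  expand : ∀ F I A B M → F * (1ℚ * 1ℚ * (B * I) + (M + A * I * (1ℚ * 1ℚ))) ≡ I * F * A + I * F * B + F * M
  expand = solve-∀ ℚ-ring

2∣n⊎2∣1+n : ∀ n → 2 ∣ n ⊎ 2 ∣ suc n
2∣n⊎2∣1+n zero    = inj₁ (2 ∣0)
2∣n⊎2∣1+n (suc n) with 2∣n⊎2∣1+n n
... | inj₁ 2∣n   = inj₂ (∣m∣n⇒∣m+n (∣-refl {2}) 2∣n)
... | inj₂ 2∣1+n = inj₁ 2∣1+n

-1^even≡1 : ∀ {n} → 2 ∣ n → (- 1ℚ) ^ n ≡ 1ℚ
-1^even≡1 (divides q refl) = -1^[q*2]≡1 q
  where
  -1^[q*2]≡1 : ∀ q → (- 1ℚ) ^ (q ℕ.* 2) ≡ 1ℚ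
  -1^[q*2]≡1 zero    = refl
  -1^[q*2]≡1 (suc q) = trans (square-neg-one ((- 1ℚ) ^ (q ℕ.* 2))) (-1^[q*2]≡1 q)
    where
    square-neg-one : ∀ x → - 1ℚ * (- 1ℚ * x) ≡ x
    square-neg-one = solve-∀ ℚ-ring

module Modulo (r : ℕ) (p-prime : Prime (suc r)) where

  p : ℕ
  p = suc r

  p∤1 : ¬ p ∣ 1
  p∤1 p∣1 = ¬prime[1] (subst Prime (∣1⇒≡1 p∣1) p-prime)

  p∤* : ∀ {a b} → ¬ p ∣ a → ¬ p ∣ b → ¬ p ∣ a ℕ.* b
  p∤* {a} {b} p∤a p∤b p∣ab = [ p∤a , p∤b ]′ (euclidsLemma a b p-prime p∣ab)

  p∤-below : ∀ {n} → 0 < n → n < p → ¬ p ∣ n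
  p∤-below {suc n} _ n<p p∣n = ℕ.<⇒≱ n<p (∣⇒≤ p∣n)

  p∤! : ∀ {n} → n < p → ¬ p ∣ n !
  p∤! {zero}  _   = p∤1
  p∤! {suc n} n<p = p∤* (p∤-below (s≤s z≤n) n<p) (p∤! (ℕ.<-trans (ℕ.n<1+n n) n<p))

  0<r : 0 < r
  0<r = ℕ.≤-pred (ℕ.nonTrivial⇒n>1 p {{prime⇒nonTrivial p-prime}})

  record Integral (x : ℚ) : Set where
    constructor integral
    field
      numerator     : ℤ
      denominator   : ℕ
      p∤denominator : ¬ p ∣ denominator
      cleared       : x * ℕ→ℚ denominator ≡ ℤ→ℚ numerator

  ℤ→ℚ-integral : ∀ a → Integral (ℤ→ℚ a)
  ℤ→ℚ-integral a = integral a 1 p∤1 (ℚ.*-identityʳ (ℤ→ℚ a))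

  ℕ→ℚ-integral : ∀ n → Integral (ℕ→ℚ n)
  ℕ→ℚ-integral n = ℤ→ℚ-integral (ℤ.+ n)

  inverse-integral : ∀ {w c} → ¬ p ∣ c → w * ℕ→ℚ c ≡ 1ℚ → Integral w
  inverse-integral {c = c} p∤c w*c≡1 = integral (ℤ.+ 1) c p∤c w*c≡1

  +-integral : ∀ {x y} → Integral x → Integral y → Integral (x + y)
  +-integral {x} {y} (integral a b p∤b x*b≡a) (integral a′ b′ p∤b′ y*b′≡a′) =
    integral (a ℤ.* ℤ.+ b′ ℤ.+ a′ ℤ.* ℤ.+ b) (b ℕ.* b′) (p∤* p∤b p∤b′) (begin
      (x + y) * ℕ→ℚ (b ℕ.* b′)                       ≡⟨ cong ((x + y) *_) (ℕ→ℚ-* b b′) ⟩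
      (x + y) * (ℕ→ℚ b * ℕ→ℚ b′)                     ≡⟨ cross-multiply x y (ℕ→ℚ b) (ℕ→ℚ b′) ⟩
      x * ℕ→ℚ b * ℕ→ℚ b′ + y * ℕ→ℚ b′ * ℕ→ℚ b        ≡⟨ cong₂ (λ u v → u * ℕ→ℚ b′ + v * ℕ→ℚ b) x*b≡a y*b′≡a′ ⟩
      ℤ→ℚ a * ℤ→ℚ (ℤ.+ b′) + ℤ→ℚ a′ * ℤ→ℚ (ℤ.+ b)   ≡⟨ sym (cong₂ _+_ (ℤ→ℚ-* a (ℤ.+ b′)) (ℤ→ℚ-* a′ (ℤ.+ b))) ⟩
      ℤ→ℚ (a ℤ.* ℤ.+ b′) + ℤ→ℚ (a′ ℤ.* ℤ.+ b)       ≡⟨ sym (ℤ→ℚ-+ (a ℤ.* ℤ.+ b′) (a′ ℤ.* ℤ.+ b)) ⟩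
      ℤ→ℚ (a ℤ.* ℤ.+ b′ ℤ.+ a′ ℤ.* ℤ.+ b)           ∎)
    where
    cross-multiply : ∀ x y b b′ → (x + y) * (b * b′) ≡ x * b * b′ + y * b′ * b
    cross-multiply = solve-∀ ℚ-ring

  *-integral : ∀ {x y} → Integral x → Integral y → Integral (x * y)
  *-integral {x} {y} (integral a b p∤b x*b≡a) (integral a′ b′ p∤b′ y*b′≡a′) =
    integral (a ℤ.* a′) (b ℕ.* b′) (p∤* p∤b p∤b′) (begin
      (x * y) * ℕ→ℚ (b ℕ.* b′)              ≡⟨ cong ((x * y) *_) (ℕ→ℚ-* b b′) ⟩
      (x * y) * (ℕ→ℚ b * ℕ→ℚ b′)            ≡⟨ interchange x y (ℕ→ℚ b) (ℕ→ℚ b′) ⟩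
      (x * ℕ→ℚ b) * (y * ℕ→ℚ b′)            ≡⟨ cong₂ _*_ x*b≡a y*b′≡a′ ⟩
      ℤ→ℚ a * ℤ→ℚ a′                        ≡⟨ sym (ℤ→ℚ-* a a′) ⟩
      ℤ→ℚ (a ℤ.* a′)                        ∎)
    where
    interchange : ∀ x y b b′ → (x * y) * (b * b′) ≡ (x * b) * (y * b′)
    interchange = solve-∀ ℚ-ring

  neg-integral : ∀ {x} → Integral x → Integral (- x)
  neg-integral {x} (integral a b p∤b x*b≡a) = integral (ℤ.- a) b p∤b (begin
    - x * ℕ→ℚ b        ≡⟨ sym (ℚ.neg-distribˡ-* x (ℕ→ℚ b)) ⟩
    - (x * ℕ→ℚ b)      ≡⟨ cong -_ x*b≡a ⟩
    - ℤ→ℚ a            ≡⟨ sym (ℤ→ℚ-neg a) ⟩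
    ℤ→ℚ (ℤ.- a)        ∎)

  ^-integral : ∀ {x} n → Integral x → Integral (x ^ n)
  ^-integral zero    _  = ℕ→ℚ-integral 1
  ^-integral (suc n) ix = *-integral ix (^-integral n ix)

  Σ-integral : ∀ n {f} → (∀ j → j < n → Integral (f j)) → Integral (Σ< n f)
  Σ-integral zero    _     = ℕ→ℚ-integral 0
  Σ-integral (suc n) ifs = +-integral (ifs 0 (s≤s z≤n)) (Σ-integral n (λ j j<n → ifs (suc j) (s≤s j<n)))

  inv!-integral : ∀ {n} → n < p → Integral (inv! n)
  inv!-integral {n} n<p = inverse-integral (p∤! n<p) (inv!*n!≡1 n)

  exp-integral : ∀ {a n} → Integral a → n < p → Integral (exp a n)
  exp-integral {n = n} ia n<p = *-integral (^-integral n ia) (inv!-integral n<p)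

  -1-integral : Integral (- 1ℚ)
  -1-integral = neg-integral (ℕ→ℚ-integral 1)

  alternating-integral : ∀ {i} → 0 < i → i < p → Integral (alternating i)
  alternating-integral {suc i} 0<i i<p = *-integral (*-integral (^-integral (suc i) -1-integral)
    (inverse-integral (p∤-below 0<i i<p) (1/n*n≡1 (suc i)))) (inv!-integral i<p)

  infix 4 _≈_

  record _≈_ (x y : ℚ) : Set where
    constructor multiple
    field
      quotient          : ℚ
      quotient-integral : Integral quotient
      difference        : x - y ≡ ℕ→ℚ p * quotient

  ≈-reflexive : ∀ {x y} → x ≡ y → x ≈ y
  ≈-reflexive {x} refl = multiple 0ℚ (ℕ→ℚ-integral 0) (trans (ℚ.+-inverseʳ x) (sym (ℚ.*-zeroʳ (ℕ→ℚ p))))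

  ≈-refl : ∀ {x} → x ≈ x
  ≈-refl = ≈-reflexive refl

  ≈-sym : ∀ {x y} → x ≈ y → y ≈ x
  ≈-sym {x} {y} (multiple q iq x-y≡pq) = multiple (- q) (neg-integral iq) (begin
    y - x               ≡⟨ swap-difference x y ⟩
    - (x - y)           ≡⟨ cong -_ x-y≡pq ⟩
    - (ℕ→ℚ p * q)       ≡⟨ ℚ.neg-distribʳ-* (ℕ→ℚ p) q ⟩
    ℕ→ℚ p * - q         ∎)
    where
    swap-difference : ∀ x y → y - x ≡ - (x - y)
    swap-difference = solve-∀ ℚ-ring

  ≈-trans : ∀ {x y z} → x ≈ y → y ≈ z → x ≈ z
  ≈-trans {x} {y} {z} (multiple q iq x-y≡pq) (multiple q′ iq′ y-z≡pq′) = multiple (q + q′) (+-integral iq iq′) (begin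
    x - z                       ≡⟨ telescope x y z ⟩
    (x - y) + (y - z)           ≡⟨ cong₂ _+_ x-y≡pq y-z≡pq′ ⟩
    ℕ→ℚ p * q + ℕ→ℚ p * q′      ≡⟨ sym (ℚ.*-distribˡ-+ (ℕ→ℚ p) q q′) ⟩
    ℕ→ℚ p * (q + q′)            ∎)
    where
    telescope : ∀ x y z → x - z ≡ (x - y) + (y - z)
    telescope = solve-∀ ℚ-ring

  ≈-setoid : Setoid 0ℓ 0ℓ
  ≈-setoid = record { _≈_ = _≈_ ; isEquivalence = record { refl = ≈-refl ; sym = ≈-sym ; trans = ≈-trans } }

  open import Relation.Binary.Reasoning.Setoid ≈-setoid using (step-≈-⟩; step-≈-⟨) renaming (begin_ to begin≈_; _∎ to _≈∎)

  +-cong : ∀ {x x′ y y′} → x ≈ x′ → y ≈ y′ → x + y ≈ x′ + y′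
  +-cong {x} {x′} {y} {y′} (multiple q iq x-x′≡pq) (multiple q′ iq′ y-y′≡pq′) =
    multiple (q + q′) (+-integral iq iq′) (begin
      x + y - (x′ + y′)            ≡⟨ regroup x x′ y y′ ⟩
      (x - x′) + (y - y′)          ≡⟨ cong₂ _+_ x-x′≡pq y-y′≡pq′ ⟩
      ℕ→ℚ p * q + ℕ→ℚ p * q′       ≡⟨ sym (ℚ.*-distribˡ-+ (ℕ→ℚ p) q q′) ⟩
      ℕ→ℚ p * (q + q′)             ∎)
    where
    regroup : ∀ x x′ y y′ → x + y - (x′ + y′) ≡ (x - x′) + (y - y′)
    regroup = solve-∀ ℚ-ring

  -‿cong : ∀ {x y} → x ≈ y → - x ≈ - y
  -‿cong {x} {y} (multiple q iq x-y≡pq) = multiple (- q) (neg-integral iq) (begin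
    - x - - y            ≡⟨ negate-difference x y ⟩
    - (x - y)            ≡⟨ cong -_ x-y≡pq ⟩
    - (ℕ→ℚ p * q)        ≡⟨ ℚ.neg-distribʳ-* (ℕ→ℚ p) q ⟩
    ℕ→ℚ p * - q          ∎)
    where
    negate-difference : ∀ x y → - x - - y ≡ - (x - y)
    negate-difference = solve-∀ ℚ-ring

  *-congˡ : ∀ {c x y} → Integral c → x ≈ y → c * x ≈ c * y
  *-congˡ {c} {x} {y} ic (multiple q iq x-y≡pq) = multiple (c * q) (*-integral ic iq) (begin
    c * x - c * y            ≡⟨ factor c x y ⟩
    c * (x - y)              ≡⟨ cong (c *_) x-y≡pq ⟩
    c * (ℕ→ℚ p * q)          ≡⟨ left-comm c (ℕ→ℚ p) q ⟩
    ℕ→ℚ p * (c * q)          ∎)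
    where
    factor : ∀ c x y → c * x - c * y ≡ c * (x - y)
    factor = solve-∀ ℚ-ring
    left-comm : ∀ a b c → a * (b * c) ≡ b * (a * c)
    left-comm = solve-∀ ℚ-ring

  *-congʳ : ∀ {c x y} → Integral c → x ≈ y → x * c ≈ y * c
  *-congʳ {c} {x} {y} ic x≈y = begin≈
    x * c   ≈⟨ ≈-reflexive (ℚ.*-comm x c) ⟩
    c * x   ≈⟨ *-congˡ ic x≈y ⟩
    c * y   ≈⟨ ≈-reflexive (ℚ.*-comm c y) ⟩
    y * c   ≈∎

  *-cong : ∀ {x x′ y y′} → Integral x′ → Integral y → x ≈ x′ → y ≈ y′ → x * y ≈ x′ * y′
  *-cong ix′ iy x≈x′ y≈y′ = ≈-trans (*-congʳ iy x≈x′) (*-congˡ ix′ y≈y′)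

  ^-cong : ∀ {x y} n → Integral x → Integral y → x ≈ y → x ^ n ≈ y ^ n
  ^-cong zero    _  _  _   = ≈-refl
  ^-cong (suc n) ix iy x≈y = *-cong iy (^-integral n ix) x≈y (^-cong n ix iy x≈y)

  Σ-cong≈ : ∀ n {f g} → (∀ j → j < n → f j ≈ g j) → Σ< n f ≈ Σ< n g
  Σ-cong≈ zero    _   = ≈-refl
  Σ-cong≈ (suc n) f≈g = +-cong (f≈g 0 (s≤s z≤n)) (Σ-cong≈ n (λ j j<n → f≈g (suc j) (s≤s j<n)))

  p*x≈0 : ∀ {x} → Integral x → ℕ→ℚ p * x ≈ 0ℚ
  p*x≈0 ix = multiple _ ix (ℚ.+-identityʳ _)

  ≈-integral : ∀ {x y} → x ≈ y → Integral y → Integral x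
  ≈-integral {x} {y} (multiple q iq x-y≡pq) iy =
    subst Integral (sym (trans (add-difference x y) (cong (y +_) x-y≡pq))) (+-integral iy (*-integral (ℕ→ℚ-integral p) iq))
    where
    add-difference : ∀ x y → x ≡ y + (x - y)
    add-difference = solve-∀ ℚ-ring

  *-cancelˡ : ∀ c .{{_ : NonZero c}} {x y} → ¬ p ∣ c → ℕ→ℚ c * x ≈ ℕ→ℚ c * y → x ≈ y
  *-cancelˡ c {x} {y} p∤c cx≈cy = begin≈
    x                        ≈⟨ ≈-reflexive (sym (cancel x)) ⟩
    (ℤ.+ 1 / c) * (ℕ→ℚ c * x) ≈⟨ *-congˡ {ℤ.+ 1 / c} (inverse-integral p∤c (1/n*n≡1 c)) cx≈cy ⟩
    (ℤ.+ 1 / c) * (ℕ→ℚ c * y) ≈⟨ ≈-reflexive (cancel y) ⟩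
    y                        ≈∎
    where
    cancel : ∀ z → (ℤ.+ 1 / c) * (ℕ→ℚ c * z) ≡ z
    cancel z = trans (sym (ℚ.*-assoc (ℤ.+ 1 / c) (ℕ→ℚ c) z)) (trans (cong (_* z) (1/n*n≡1 c)) (ℚ.*-identityˡ z))

  ≈⇒≡[modℚ] : ∀ {x y} → x ≈ y → x ≡ y [modℚ p ]
  ≈⇒≡[modℚ] {x} {y} (multiple q (integral a b p∤b q*b≡a) x-y≡pq) = a , ℤ.+ b , p∤b , (begin
    (x - y) * ℕ→ℚ b          ≡⟨ cong (_* ℕ→ℚ b) x-y≡pq ⟩
    ℕ→ℚ p * q * ℕ→ℚ b        ≡⟨ ℚ.*-assoc (ℕ→ℚ p) q (ℕ→ℚ b) ⟩
    ℕ→ℚ p * (q * ℕ→ℚ b)      ≡⟨ cong (ℕ→ℚ p *_) q*b≡a ⟩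
    ℕ→ℚ p * ℤ→ℚ a            ∎)

  frobenius : ∀ {a b} → Integral a → Integral b → (a + b) ^ p ≈ a ^ p + b ^ p
  frobenius {a} {b} ia ib = multiple (ℕ→ℚ (r !) * M) M-integral (begin
    (a + b) ^ p - (a ^ p + b ^ p)                     ≡⟨ cong (_- (a ^ p + b ^ p)) (binomial-ends r a b) ⟩
    a ^ p + b ^ p + ℕ→ℚ (p !) * M - (a ^ p + b ^ p)   ≡⟨ cancel (a ^ p + b ^ p) (ℕ→ℚ (p !) * M) ⟩
    ℕ→ℚ (p !) * M                                     ≡⟨ cong (_* M) (ℕ→ℚ-* p (r !)) ⟩
    ℕ→ℚ p * ℕ→ℚ (r !) * M                             ≡⟨ ℚ.*-assoc (ℕ→ℚ p) (ℕ→ℚ (r !)) M ⟩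
    ℕ→ℚ p * (ℕ→ℚ (r !) * M)                           ∎)
    where
    M = Σ[ j < r ] (exp a (suc j) * exp b (r ∸ j))
    M-integral : Integral (ℕ→ℚ (r !) * M)
    M-integral = *-integral (ℕ→ℚ-integral (r !)) (Σ-integral r λ j j<r →
      *-integral (exp-integral ia (s≤s j<r)) (exp-integral ib (s≤s (ℕ.m∸n≤m r j))))
    cancel : ∀ s t → s + t - s ≡ t
    cancel = solve-∀ ℚ-ring

  fermat : ∀ a → ℕ→ℚ a ^ p ≈ ℕ→ℚ a
  fermat zero    = ≈-reflexive (ℚ.*-zeroˡ (0ℚ ^ r))
  fermat (suc a) = begin≈
    ℕ→ℚ (suc a) ^ p          ≈⟨ ≈-reflexive (cong (_^ p) (ℕ→ℚ-suc a)) ⟩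
    (1ℚ + ℕ→ℚ a) ^ p         ≈⟨ frobenius (ℕ→ℚ-integral 1) (ℕ→ℚ-integral a) ⟩
    1ℚ ^ p + ℕ→ℚ a ^ p       ≈⟨ +-cong (≈-reflexive (1^n≡1 p)) (fermat a) ⟩
    1ℚ + ℕ→ℚ a               ≈⟨ ≈-reflexive (sym (ℕ→ℚ-suc a)) ⟩
    ℕ→ℚ (suc a)              ≈∎

  fermat-unit : ∀ {a} → 0 < a → a < p → ℕ→ℚ a ^ r ≈ 1ℚ
  fermat-unit {a@(suc _)} 0<a a<p = *-cancelˡ a (p∤-below 0<a a<p) (begin≈
    ℕ→ℚ a * ℕ→ℚ a ^ r   ≈⟨ fermat a ⟩
    ℕ→ℚ a               ≈⟨ ≈-reflexive (sym (ℚ.*-identityʳ (ℕ→ℚ a))) ⟩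
    ℕ→ℚ a * 1ℚ          ≈∎)

  p^n≈0 : ∀ {n} → 0 < n → ℕ→ℚ p ^ n ≈ 0ℚ
  p^n≈0 {suc n} _ = p*x≈0 (^-integral n (ℕ→ℚ-integral p))

  r≈-1 : ℕ→ℚ r ≈ - 1ℚ
  r≈-1 = multiple 1ℚ (ℕ→ℚ-integral 1) (begin
    ℕ→ℚ r - - 1ℚ      ≡⟨ add-one (ℕ→ℚ r) ⟩
    1ℚ + ℕ→ℚ r        ≡⟨ sym (ℕ→ℚ-suc r) ⟩
    ℕ→ℚ p             ≡⟨ sym (ℚ.*-identityʳ (ℕ→ℚ p)) ⟩
    ℕ→ℚ p * 1ℚ        ∎)
    where
    add-one : ∀ x → x - - 1ℚ ≡ 1ℚ + x
    add-one = solve-∀ ℚ-ring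

  p∤i+p : ∀ {i} → 0 < i → i < p → ¬ p ∣ i ℕ.+ p
  p∤i+p {i} 0<i i<p p∣i+p = p∤-below 0<i i<p (∣m+n∣m⇒∣n (subst (p ∣_) (ℕ.+-comm i p) p∣i+p) ∣-refl)

  module _ (p≢2 : p ≢ 2) where

    2∣r : 2 ∣ r
    2∣r with 2∣n⊎2∣1+n r
    ... | inj₁ 2∣r = 2∣r
    ... | inj₂ 2∣p = ⊥-elim ([ (λ ()) , (p≢2 ∘ sym) ]′ (prime⇒irreducible p-prime 2∣p))

    -- Wilson's theorem, from the finite-difference identity Σ_j (-1)^(r-j) C(r,j) j^r = r! and Fermat.
    wilson : ℕ→ℚ (r !) ≈ - 1ℚ
    wilson = begin≈
      ℕ→ℚ (r !)                                     ≈⟨ ≈-reflexive (sym (Σ-signedBinomial-pow r)) ⟩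
      c 0 * 0ℚ ^ r + Σ[ j < r ] (c (suc j) * ℕ→ℚ (suc j) ^ r)
        ≈⟨ +-cong (≈-refl {c 0 * 0ℚ ^ r}) (Σ-cong≈ r λ j j<r → *-congˡ (c-integral (suc j)) (fermat-unit (s≤s z≤n) (s≤s j<r))) ⟩
      c 0 * 0ℚ ^ r + Σ[ j < r ] (c (suc j) * 1ℚ)    ≈⟨ ≈-reflexive alternating-sum ⟩
      - 1ℚ                                          ≈∎
      where
      c = signedBinomial r
      c-integral : ∀ j → Integral (c j)
      c-integral j = *-integral (ℕ→ℚ-integral (r C j)) (^-integral (r ∸ j) -1-integral)
      split-off : ∀ a s → 0ℚ + s ≡ (a + s) - a
      split-off = solve-∀ ℚ-ring
      alternating-sum : c 0 * 0ℚ ^ r + Σ[ j < r ] (c (suc j) * 1ℚ) ≡ - 1ℚ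
      alternating-sum = begin
        c 0 * 0ℚ ^ r + Σ[ j < r ] (c (suc j) * 1ℚ)
          ≡⟨ cong₂ _+_ (trans (cong (c 0 *_) (0^n≡0 0<r)) (ℚ.*-zeroʳ (c 0))) (Σ-cong r (λ j _ → ℚ.*-identityʳ (c (suc j)))) ⟩
        0ℚ + Σ[ j < r ] c (suc j)                ≡⟨ split-off (c 0) (Σ[ j < r ] c (suc j)) ⟩
        Σ[ j < suc r ] c j - c 0                 ≡⟨ cong₂ _-_ (Σ-signedBinomial r 0<r) (trans (ℚ.*-identityˡ ((- 1ℚ) ^ r)) (-1^even≡1 2∣r)) ⟩
        0ℚ - 1ℚ                                  ∎

    inv!r≈-1 : inv! r ≈ - 1ℚ
    inv!r≈-1 = begin≈
      inv! r                         ≈⟨ ≈-reflexive (negate-twice (inv! r)) ⟩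
      - (inv! r * - 1ℚ)              ≈⟨ -‿cong (*-congˡ (inv!-integral (ℕ.n<1+n r)) (≈-sym wilson)) ⟩
      - (inv! r * ℕ→ℚ (r !))         ≈⟨ ≈-reflexive (cong -_ (inv!*n!≡1 r)) ⟩
      - 1ℚ                           ≈∎
      where
      negate-twice : ∀ x → x ≡ - (x * - 1ℚ)
      negate-twice = solve-∀ ℚ-ring

    expTrunc^⋆p-at-p≈1 : (expTrunc r ^⋆ p) p ≈ 1ℚ
    expTrunc^⋆p-at-p≈1 = begin≈
      (expTrunc r ^⋆ p) p                 ≈⟨ ≈-reflexive (expTrunc^⋆p-at-p r) ⟩
      ℕ→ℚ p ^ r * inv! r - inv! r         ≈⟨ +-cong (*-congʳ (inv!-integral (ℕ.n<1+n r)) (p^n≈0 0<r)) (-‿cong inv!r≈-1) ⟩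
      0ℚ * inv! r - - 1ℚ                  ≈⟨ ≈-reflexive (cong (_- - 1ℚ) (ℚ.*-zeroˡ (inv! r))) ⟩
      1ℚ                                  ≈∎

    inv!r*expTrunc^⋆r≈ : ∀ {i} → i ≤ r → inv! r * (expTrunc r ^⋆ r) i ≈ - ((- 1ℚ) ^ i * inv! i)
    inv!r*expTrunc^⋆r≈ {i} i≤r = begin≈
      inv! r * (expTrunc r ^⋆ r) i        ≈⟨ ≈-reflexive (cong (inv! r *_) (expTrunc-^⋆-≤ r i≤r)) ⟩
      inv! r * (ℕ→ℚ r ^ i * inv! i)       ≈⟨ *-cong (-1-integral) (*-integral (^-integral i (ℕ→ℚ-integral r)) (inv!-integral (s≤s i≤r)))
                                                     inv!r≈-1 (*-congʳ (inv!-integral (s≤s i≤r)) (^-cong i (ℕ→ℚ-integral r) -1-integral r≈-1)) ⟩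
      - 1ℚ * ((- 1ℚ) ^ i * inv! i)        ≈⟨ ≈-reflexive (sym (ℚ.neg-distribˡ-* 1ℚ ((- 1ℚ) ^ i * inv! i))) ⟩
      - (1ℚ * ((- 1ℚ) ^ i * inv! i))      ≈⟨ ≈-reflexive (cong -_ (ℚ.*-identityˡ ((- 1ℚ) ^ i * inv! i))) ⟩
      - ((- 1ℚ) ^ i * inv! i)             ≈∎

    innerSum-1≈0 : innerSum p 1 ≈ 0ℚ
    innerSum-1≈0 = *-cancelˡ (1 ℕ.+ p) (p∤i+p (s≤s z≤n) (s≤s 0<r)) (begin≈
      ℕ→ℚ (1 ℕ.+ p) * innerSum p 1                         ≈⟨ ≈-reflexive (innerSum-recurrence r 0) ⟩
      (expTrunc r ^⋆ p) p - inv! r * (expTrunc r ^⋆ r) 1   ≈⟨ +-cong expTrunc^⋆p-at-p≈1 (-‿cong (inv!r*expTrunc^⋆r≈ 0<r)) ⟩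
      1ℚ - - ((- 1ℚ) ^ 1 * inv! 1)                          ≈⟨ ≈-reflexive (sym (ℚ.*-zeroʳ (ℕ→ℚ (1 ℕ.+ p)))) ⟩
      ℕ→ℚ (1 ℕ.+ p) * 0ℚ                                   ≈∎)

    innerSum-step : ∀ i → Integral (innerSum p (suc i)) → suc (suc i) ≤ r →
                    innerSum p (suc (suc i)) ≈ alternating (suc (suc i))
    innerSum-step i s-integral j≤r = *-cancelˡ (j ℕ.+ p) (p∤i+p (s≤s z≤n) (s≤s j≤r)) (begin≈
      ℕ→ℚ (j ℕ.+ p) * innerSum p j
        ≈⟨ ≈-reflexive (innerSum-recurrence r (suc i)) ⟩
      (expTrunc r ^⋆ p) (suc i ℕ.+ p) - inv! r * (expTrunc r ^⋆ r) j
        ≈⟨ +-cong (≈-trans (≈-reflexive (sym (p*innerSum r (suc i)))) (p*x≈0 s-integral)) (-‿cong (inv!r*expTrunc^⋆r≈ j≤r)) ⟩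
      0ℚ - - ((- 1ℚ) ^ j * inv! j)
        ≈⟨ ≈-reflexive (trans (negate-twice ((- 1ℚ) ^ j * inv! j)) (sym (j*alternating-j))) ⟩
      ℕ→ℚ j * alternating j
        ≈⟨ ≈-sym (add-multiple-of-p) ⟩
      ℕ→ℚ (j ℕ.+ p) * alternating j ≈∎)
      where
      j = suc (suc i)
      negate-twice : ∀ x → 0ℚ - - x ≡ x
      negate-twice = solve-∀ ℚ-ring
      j*alternating-j : ℕ→ℚ j * alternating j ≡ (- 1ℚ) ^ j * inv! j
      j*alternating-j = trans (regroup (ℕ→ℚ j) ((- 1ℚ) ^ j) (recip j) (inv! j))
        (trans (cong ((- 1ℚ) ^ j * inv! j *_) (1/n*n≡1 j)) (ℚ.*-identityʳ _))
        where
        regroup : ∀ n s c i → n * (s * c * i) ≡ s * i * (c * n)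
        regroup = solve-∀ ℚ-ring
      add-multiple-of-p : ℕ→ℚ (j ℕ.+ p) * alternating j ≈ ℕ→ℚ j * alternating j
      add-multiple-of-p = begin≈
        ℕ→ℚ (j ℕ.+ p) * alternating j                           ≈⟨ ≈-reflexive (trans (cong (_* alternating j) (ℕ→ℚ-+ j p))
                                                                                        (ℚ.*-distribʳ-+ (alternating j) (ℕ→ℚ j) (ℕ→ℚ p))) ⟩
        ℕ→ℚ j * alternating j + ℕ→ℚ p * alternating j          ≈⟨ +-cong (≈-refl {ℕ→ℚ j * alternating j}) (p*x≈0 (alternating-integral (s≤s z≤n) (s≤s j≤r))) ⟩
        ℕ→ℚ j * alternating j + 0ℚ                              ≈⟨ ≈-reflexive (ℚ.+-identityʳ _) ⟩
        ℕ→ℚ j * alternating j                                   ≈∎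

    innerSum-≥2 : ∀ i → suc (suc i) ≤ r → innerSum p (suc (suc i)) ≈ alternating (suc (suc i))
    innerSum-≥2 zero    j≤r = innerSum-step 0 (≈-integral innerSum-1≈0 (ℕ→ℚ-integral 0)) j≤r
    innerSum-≥2 (suc i) j≤r = innerSum-step (suc i) previous-integral j≤r
      where
      previous-integral : Integral (innerSum p (suc (suc i)))
      previous-integral = ≈-integral (innerSum-≥2 i (ℕ.<⇒≤ j≤r)) (alternating-integral (s≤s z≤n) (ℕ.<-trans j≤r (ℕ.n<1+n r)))

    weighted-innerSums≈ : ∀ k → 1 ≤ k → k ≤ r →
      sumFrom 1 k (λ i → inv! (k ∸ i) * innerSum p i) - inv! (k ∸ 1) ≈ - (inv! k * H k)
    weighted-innerSums≈ k@(suc k′) _ k≤r = begin≈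
      sumFrom 1 k (λ i → inv! (k ∸ i) * innerSum p i) - inv! k′
        ≈⟨ ≈-reflexive (cong (_- inv! k′) (sumFrom-1 k (λ i → inv! (k ∸ i) * innerSum p i))) ⟩
      inv! k′ * innerSum p 1 + Σ[ j < k′ ] (inv! (k′ ∸ suc j) * innerSum p (suc (suc j))) - inv! k′
        ≈⟨ +-cong (+-cong (*-congˡ (inv!-integral (ℕ.m≤n⇒m≤1+n k≤r)) innerSum-1≈0)
                          (Σ-cong≈ k′ λ j j<k′ → *-congˡ (inv!-integral (s≤s (ℕ.≤-trans (ℕ.m∸n≤m k′ (suc j)) (ℕ.<⇒≤ k≤r))))
                                                          (innerSum-≥2 j (ℕ.≤-trans (s≤s j<k′) k≤r))))
                  (≈-refl { - inv! k′}) ⟩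
      inv! k′ * 0ℚ + Σ[ j < k′ ] (inv! (k′ ∸ suc j) * alternating (suc (suc j))) - inv! k′
        ≈⟨ ≈-reflexive (absorb (inv! k′) (Σ[ j < k′ ] (inv! (k′ ∸ suc j) * alternating (suc (suc j))))) ⟩
      Σ[ j < k ] (inv! (k ∸ suc j) * alternating (suc j))
        ≈⟨ ≈-reflexive (harmonic-identity k) ⟩
      - (inv! k * H k) ≈∎
      where
      absorb : ∀ a s → a * 0ℚ + s - a ≡ a * - 1ℚ + s
      absorb = solve-∀ ℚ-ring

theorem2p7 : (p k : ℕ) → Prime p → p ≢ 2 → 1 ≤ k → k ≤ p ∸ 1 →
    (sumFrom 1 k (λ i → inv! (k ∸ i) * sumFrom 1 p (λ m →
        ℕ→ℚ ((p ∸ 1) !) * inv! (p ∸ m) * inv! (i ℕ.+ p) * ℕ→ℚ (stirling≤ (p ∸ 1) (i ℕ.+ p) m)))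
      - inv! (k ∸ 1))
    ≡ - (inv! k * H k) [modℚ p ]
theorem2p7 zero    k p-prime = ⊥-elim (¬prime[0] p-prime)
theorem2p7 (suc r) k p-prime p≢2 1≤k k≤r = ≈⇒≡[modℚ] (weighted-innerSums≈ p≢2 k 1≤k k≤r)
  where
  open Modulo r p-prime
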